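{- As $q\to\infty$ through integers prime to $3$: (a) $\lim_{q\to\infty}\frac{N(3,q)}{q^2}=\lim_{q\to\infty}\frac{\mathrm{Medim}(3,q)}{q^2}=\frac1{12}$; (b) $\lim_{q\to\infty}\frac{\mathrm{Sym}(3,q)}{q}=\lim_{q\to\infty}\frac{\mathrm{Psym}(3,q)}{q}=\frac12$.
   Context: A numerical semigroup is an additive submonoid $H\subseteq\mathbb N=\{0,1,\dots\}$ with finite complement; $g(H)=|\mathbb N\setminus H|$ and $F(H)$ is the largest integer not in $H$. $H$ is symmetric if $2g(H)=F(H)+1$ and pseudo-symmetric if $2g(H)=F(H)+2$. For $q$ prime to $p$: $N(p,q)$ is the number of numerical semigroups containing $p$ and $q$; $\mathrm{Medim}(p,q)$ the number of those of maximal embedding dimension $p$ (minimal generating set of exactly $p$ elements, smallest positive element $p$); $\mathrm{Sym}(p,q)$ and $\mathrm{Psym}(p,q)$ the numbers of symmetric, resp. pseudo-symmetric, ones. -}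

module Defs where

open import Data.Nat using (ℕ; zero; suc; _+_; _*_; _≤_; _<_)
open import Data.Nat.Coprimality using (Coprime)
open import Data.Bool using (Bool; true; false)
open import Data.Vec using (Vec; []; _∷_)
open import Data.List using (List; length)
open import Data.List.Membership.Propositional using (_∈_)
open import Data.List.Relation.Unary.Unique.Propositional using (Unique)
open import Data.Product using (Σ; ∃; ∃₂; _×_; _,_)
open import Data.Integer using (+_)
open import Data.Rational as ℚ using (ℚ; 0ℚ)
open import Relation.Binary.PropositionalEquality using (_≡_)
open import Relation.Nullary using (¬_)

CountIs : {A : Set} → (A → Set) → ℕ → Set
CountIs {A} P n =
  Σ (List A) λ xs → Unique xs × (∀ x → x ∈ xs → P x) × (∀ x → P x → x ∈ xs) × length xs ≡ n

IsNumericalSemigroup : (ℕ → Set) → Set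
IsNumericalSemigroup H =
  H 0 × (∀ a b → H a → H b → H (a + b)) × (∃ λ c → ∀ n → c ≤ n → H n)

Genus : (ℕ → Set) → ℕ → Set
Genus H g = CountIs (λ n → ¬ H n) g

-- conductor c = F(H) + 1 (smallest c with [c,∞) ⊆ H; c = 0 for H = ℕ, i.e. F(ℕ) = -1)
IsConductor : (ℕ → Set) → ℕ → Set
IsConductor H c = (∀ n → c ≤ n → H n) × (∀ d → (∀ n → d ≤ n → H n) → c ≤ d)

-- symmetric: 2 g = F + 1 = c ; pseudo-symmetric: 2 g = F + 2 = c + 1
Symmetric : (ℕ → Set) → Set
Symmetric H = ∃₂ λ g c → Genus H g × IsConductor H c × 2 * g ≡ c

PseudoSymmetric : (ℕ → Set) → Set
PseudoSymmetric H = ∃₂ λ g c → Genus H g × IsConductor H c × 2 * g ≡ c + 1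

Multiplicity : (ℕ → Set) → ℕ → Set
Multiplicity H m = 0 < m × H m × (∀ k → 0 < k → H k → m ≤ k)

MinimalGenerator : (ℕ → Set) → ℕ → Set
MinimalGenerator H x =
  0 < x × H x × ¬ (∃₂ λ a b → 0 < a × 0 < b × H a × H b × a + b ≡ x)

EmbeddingDimension : (ℕ → Set) → ℕ → Set
EmbeddingDimension H e = CountIs (MinimalGenerator H) e

-- Encoding: a numerical semigroup containing p and q contains every n ≥ p*q
-- (indeed every n ≥ (p-1)(q-1)), so it is determined by its membership on
-- [0, p*q); a vector v encodes the set {n | n < p*q, v[n] = true} ∪ [p*q, ∞).
mem : ∀ {m} → Vec Bool m → ℕ → Bool
mem [] n = true
mem (b ∷ v) zero = b
mem (b ∷ v) (suc n) = mem v n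

In : ∀ {m} → Vec Bool m → ℕ → Set
In v n = mem v n ≡ true

SG : (p q : ℕ) → Vec Bool (p * q) → Set
SG p q v = IsNumericalSemigroup (In v) × In v p × In v q

NCount : ℕ → ℕ → ℕ → Set
NCount p q n = CountIs (SG p q) n

MedimCount : ℕ → ℕ → ℕ → Set
MedimCount p q n =
  CountIs (λ v → SG p q v × Multiplicity (In v) p × EmbeddingDimension (In v) p) n

SymCount : ℕ → ℕ → ℕ → Set
SymCount p q n = CountIs (λ v → SG p q v × Symmetric (In v)) n

PsymCount : ℕ → ℕ → ℕ → Set
PsymCount p q n = CountIs (λ v → SG p q v × PseudoSymmetric (In v)) n

-- n / d as a rational (d = 0 gives 0; irrelevant for large q)
ratio : ℕ → ℕ → ℚ
ratio n zero = 0ℚ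
ratio n (suc d) = (+ n) ℚ./ suc d

-- lim_{q→∞, gcd(q,3)=1} R(q) / scale(q) = L, where R q n means "the count at q is n"
LimitPrimeTo3 : (ℕ → ℕ → Set) → (ℕ → ℕ) → ℚ → Set
LimitPrimeTo3 R scale L =
  ∀ ε → 0ℚ ℚ.< ε → ∃ λ Q → ∀ q → Q ≤ q → Coprime 3 q →
    ∃ λ n → R q n × ℚ.∣ ratio n (scale q) ℚ.- L ∣ ℚ.< ε

-- A numerical semigroup H containing 3 is determined by its Kunz coordinates (x, y): 3x+1 and 3y+2 are
-- its least elements congruent to 1 and 2 mod 3, and the pairs that occur are those with y ≤ 2x and
-- x ≤ 2y+1. For q = 3a+1 (resp. 3a+2), q ∈ H adds x ≤ a (resp. y ≤ a), so N(3,q) counts the lattice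
-- points of a triangle of area q²/12 and 12 N(3,q) = q² + O(q). The genus is x+y and the conductor is 3y
-- or 3x−1, so H is symmetric exactly on the lines y = 2x and x = 2y+1, and pseudo-symmetric exactly on
-- x = 2y (y ≥ 1) and 2x = y+1; either pair of lines meets the triangle in q/3 + q/6 + O(1) points.
-- H has maximal embedding dimension unless x = 0, y = 0 or H is symmetric, so Medim(3,q) = N(3,q) + O(q).

module Submission where

open import Defs
open import Data.Bool as Bool using (Bool; true)
open import Data.Bool.Properties using (T-≡; ⇔→≡)
open import Data.Empty using (⊥-elim)
open import Data.Integer as ℤ using (+_; -[1+_]; _⊖_)
import Data.Integer.Properties as ℤ
open import Data.List using (List; []; _∷_; _++_; map; length; filter; upTo)
open import Data.List.Properties using (length-++; length-++-sucʳ; length-map; length-upTo)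
open import Data.List.Membership.Propositional using (_∈_)
open import Data.List.Membership.Propositional.Properties
  using (∈-∃++; ∈-++⁺ˡ; ∈-++⁺ʳ; ∈-++⁻; ∈-map⁺; ∈-map⁻; ∈-filter⁺; ∈-filter⁻; ∈-upTo⁺; ∈-upTo⁻)
import Data.List.Relation.Unary.All as All
open import Data.List.Relation.Unary.AllPairs using ([]; _∷_)
open import Data.List.Relation.Unary.All.Properties as All using ()
open import Data.List.Relation.Unary.Any using (here; there)
open import Data.List.Relation.Unary.Unique.Propositional using (Unique)
import Data.List.Relation.Unary.Unique.Propositional.Properties as Unique
open import Data.Nat as ℕ
  using (ℕ; zero; suc; pred; _+_; _*_; _∸_; _≤_; _<_; _≤ᵇ_; z≤n; s≤s; ∣_-_∣; ⌊_/2⌋)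
open import Data.Nat.Divisibility using (∣-refl; m∣m*n; _∣0)
open import Data.Nat.DivMod using (_%_; [m+kn]%n≡m%n)
open import Data.Nat.Induction using (<-rec)
open import Data.Vec using (Vec; []; _∷_)
open import Data.Nat.Properties as ℕ using (≤-refl; ≤-trans; module ≤-Reasoning)
open import Data.Nat.Coprimality using (Coprime)
open import Data.Nat.Tactic.RingSolver using (solve-∀)
open import Data.Product using (∃; ∃₂; _×_; _,_; proj₁; proj₂; uncurry; swap)
open import Data.Sum using (_⊎_; inj₁; inj₂; [_,_])
open import Data.Unit using (⊤; tt)
open import Function using (_∘_; _⇔_; Equivalence; mk⇔)
open Equivalence using (to; from)
open import Level using (0ℓ)
open import Relation.Nullary using (¬_; yes; no; contradiction)
open import Relation.Nullary.Decidable using (_×-dec_; _⊎-dec_; ¬?)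
open import Relation.Unary using (Pred; _⊆_; _∪_; _∩_; Empty; Decidable)
open import Relation.Binary.PropositionalEquality hiding ([_])
open import Data.Rational as ℚ using (mkℚ; _/_; toℚᵘ)
import Data.Rational.Properties as ℚ
open import Data.Rational.Unnormalised as ℚᵘ using (mkℚᵘ; *<*)
import Data.Rational.Unnormalised.Properties as ℚᵘ

module _ {A : Set} where

  Unique-⊆⇒length-≤ : {xs ys : List A} → Unique xs → (∀ {z} → z ∈ xs → z ∈ ys) →
                      length xs ≤ length ys
  Unique-⊆⇒length-≤ {[]} _ _ = z≤n
  Unique-⊆⇒length-≤ {x ∷ xs} {ys} (x∉xs ∷ uxs) xs⊆ys with ∈-∃++ (xs⊆ys (here refl))
  ... | pre , post , refl =
    ≤-trans (s≤s (Unique-⊆⇒length-≤ uxs xs⊆pre++post)) (ℕ.≤-reflexive (sym (length-++-sucʳ pre x post)))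
    where
    xs⊆pre++post : ∀ {z} → z ∈ xs → z ∈ pre ++ post
    xs⊆pre++post z∈xs with ∈-++⁻ pre (xs⊆ys (there z∈xs))
    ... | inj₁ z∈pre = ∈-++⁺ˡ z∈pre
    ... | inj₂ (here refl) = ⊥-elim (All.lookup x∉xs z∈xs refl)
    ... | inj₂ (there z∈post) = ∈-++⁺ʳ pre z∈post

  CountIs-≤-length : ∀ {P : Pred A 0ℓ} {n ys} → CountIs P n → (∀ {z} → P z → z ∈ ys) → n ≤ length ys
  CountIs-≤-length (xs , u , sound , _ , refl) P⊆ys = Unique-⊆⇒length-≤ u (λ z∈xs → P⊆ys (sound _ z∈xs))

  CountIs-mono : ∀ {P Q : Pred A 0ℓ} {m n} → P ⊆ Q → CountIs P m → CountIs Q n → m ≤ n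
  CountIs-mono P⊆Q #P (ys , _ , _ , complete , refl) = CountIs-≤-length #P (λ Pz → complete _ (P⊆Q Pz))

  CountIs-cong : ∀ {P Q : Pred A 0ℓ} {n} → P ⊆ Q → Q ⊆ P → CountIs P n → CountIs Q n
  CountIs-cong P⊆Q Q⊆P (xs , u , sound , complete , len) =
    xs , u , (λ z z∈xs → P⊆Q (sound z z∈xs)) , (λ z Qz → complete z (Q⊆P Qz)) , len

  CountIs-∪ : ∀ {P Q : Pred A 0ℓ} {m n} → (∀ {z} → P z → ¬ Q z) →
              CountIs P m → CountIs Q n → CountIs (P ∪ Q) (m + n)
  CountIs-∪ P∩Q=∅ (xs , u , sound , complete , refl) (ys , v , sound′ , complete′ , refl) =
    xs ++ ys ,
    Unique.++⁺ u v (λ (z∈xs , z∈ys) → P∩Q=∅ (sound _ z∈xs) (sound′ _ z∈ys)) ,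
    (λ z z∈ → Data.Sum.map (sound z) (sound′ z) (∈-++⁻ xs z∈)) ,
    (λ { z (inj₁ Pz) → ∈-++⁺ˡ (complete z Pz) ; z (inj₂ Qz) → ∈-++⁺ʳ xs (complete′ z Qz) }) ,
    length-++ xs

  CountIs-filter : ∀ {P Q : Pred A 0ℓ} {n} → Decidable Q → CountIs P n → ∃ λ m → CountIs (P ∩ Q) m
  CountIs-filter Q? (xs , u , sound , complete , _) =
    length (filter Q? xs) , filter Q? xs , Unique.filter⁺ Q? u ,
    (λ z z∈ → let z∈xs , Qz = ∈-filter⁻ Q? z∈ in sound z z∈xs , Qz) ,
    (λ z (Pz , Qz) → ∈-filter⁺ Q? (complete z Pz) Qz) , refl

  CountIs-unique : ∀ {P : Pred A 0ℓ} {m n} → CountIs P m → CountIs P n → m ≡ n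
  CountIs-unique #m #n = ℕ.≤-antisym (CountIs-mono (λ Pz → Pz) #m #n) (CountIs-mono (λ Pz → Pz) #n #m)

  CountIs-empty : ∀ {P : Pred A 0ℓ} → Empty P → CountIs P 0
  CountIs-empty P=∅ = [] , [] , (λ _ ()) , (λ z Pz → ⊥-elim (P=∅ z Pz)) , refl

map-unique : ∀ {A B : Set} (f : A → B) {xs : List A} →
             (∀ {a b} → a ∈ xs → b ∈ xs → f a ≡ f b → a ≡ b) → Unique xs → Unique (map f xs)
map-unique f _ [] = []
map-unique f inj (x∉xs ∷ u) =
  All.map⁺ (All.tabulate λ z∈xs fx≡fz → All.lookup x∉xs z∈xs (inj (here refl) (there z∈xs) fx≡fz))
  ∷ map-unique f (λ a∈ b∈ → inj (there a∈) (there b∈)) u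

CountIs-image : ∀ {A B : Set} {P : Pred A 0ℓ} {Q : Pred B 0ℓ} {n} (f : A → B) →
                (∀ {a b} → P a → P b → f a ≡ f b → a ≡ b) →
                (∀ {a} → P a → Q (f a)) → (∀ {b} → Q b → ∃ λ a → P a × f a ≡ b) →
                CountIs P n → CountIs Q n
CountIs-image {Q = Q} f inj P→Q Q→P (xs , u , sound , complete , refl) =
  map f xs ,
  map-unique f (λ a∈ b∈ → inj (sound _ a∈) (sound _ b∈)) u ,
  (λ b b∈ → let a , a∈ , b≡fa = ∈-map⁻ f b∈ in subst Q (sym b≡fa) (P→Q (sound a a∈))) ,
  (λ b Qb → let a , Pa , fa≡b = Q→P Qb in subst (_∈ map f xs) fa≡b (∈-map⁺ f (complete a Pa))) ,
  length-map f xs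

CountIs-< : ∀ k → CountIs (_< k) k
CountIs-< k = upTo k , Unique.upTo⁺ k , (λ _ → ∈-upTo⁻) , (λ _ → ∈-upTo⁺) , length-upTo k

CountIs-interval : ∀ lo hi → CountIs (λ y → lo ≤ y × y < hi) (hi ∸ lo)
CountIs-interval lo hi =
  CountIs-image (λ t → lo + t) (λ _ _ → ℕ.+-cancelˡ-≡ lo _ _) into onto (CountIs-< (hi ∸ lo))
  where
  into : ∀ {t} → t < hi ∸ lo → lo ≤ lo + t × lo + t < hi
  into {t} t<hi∸lo = ℕ.m≤m+n lo t , (begin-strict
    lo + t          <⟨ ℕ.+-monoʳ-< lo t<hi∸lo ⟩
    lo + (hi ∸ lo)  ≡⟨ ℕ.m+[n∸m]≡n lo≤hi ⟩
    hi              ∎)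
    where
    open ≤-Reasoning
    lo≤hi : lo ≤ hi
    lo≤hi = ℕ.<⇒≤ (ℕ.m∸n≢0⇒n<m {hi} {lo} (ℕ.>⇒≢ (ℕ.≤-<-trans z≤n t<hi∸lo)))
  onto : ∀ {y} → lo ≤ y × y < hi → ∃ λ t → t < hi ∸ lo × lo + t ≡ y
  onto (lo≤y , y<hi) = _ , ℕ.∸-monoˡ-< y<hi lo≤y , ℕ.m+[n∸m]≡n lo≤y

Range : {B : Set} → (ℕ → B) → ℕ → Pred B 0ℓ
Range f k b = ∃ λ t → t < k × f t ≡ b

CountIs-Range : ∀ {B : Set} {f : ℕ → B} {k} → (∀ {s t} → f s ≡ f t → s ≡ t) → CountIs (Range f k) k
CountIs-Range {f = f} {k} f-injective =
  CountIs-image f (λ _ _ → f-injective) (λ t<k → _ , t<k , refl) (λ line → line) (CountIs-< k)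

CountIs-Range-∪ : ∀ {B : Set} {f g : ℕ → B} {k l} →
                  (∀ {s t} → f s ≡ f t → s ≡ t) → (∀ {s t} → g s ≡ g t → s ≡ t) →
                  (∀ {s t} → f s ≢ g t) →
                  CountIs (Range f k ∪ Range g l) (k + l)
CountIs-Range-∪ f-injective g-injective f≢g =
  CountIs-∪ (λ (_ , _ , fs≡b) (_ , _ , gt≡b) → f≢g (trans fs≡b (sym gt≡b)))
            (CountIs-Range f-injective) (CountIs-Range g-injective)

Σ< : ℕ → (ℕ → ℕ) → ℕ
Σ< zero r = 0
Σ< (suc a) r = Σ< a r + r a

CountIs-rows : {R : ℕ → Pred ℕ 0ℓ} {r : ℕ → ℕ} → (∀ x → CountIs (R x) (r x)) →
               ∀ a → CountIs (uncurry λ x y → x < a × R x y) (Σ< a r)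
CountIs-rows #R zero = CountIs-empty λ { _ (() , _) }
CountIs-rows {R} {r} #R (suc a) =
  CountIs-cong earlier∪last⊆ ⊆earlier∪last
    (CountIs-∪ (λ (x<a , _) (x≡a , _) → ℕ.<-irrefl x≡a x<a) (CountIs-rows #R a) last-row)
  where
  Earlier Last : Pred (ℕ × ℕ) 0ℓ
  Earlier = uncurry λ x y → x < a × R x y
  Last = uncurry λ x y → x ≡ a × R x y
  last-row : CountIs Last (r a)
  last-row = CountIs-image (a ,_) (λ _ _ → cong proj₂) (λ Ry → refl , Ry) (λ { (refl , Ry) → _ , Ry , refl })
                           (#R a)
  earlier∪last⊆ : Earlier ∪ Last ⊆ uncurry λ x y → x < suc a × R x y
  earlier∪last⊆ (inj₁ (x<a , Rxy)) = ℕ.m≤n⇒m≤1+n x<a , Rxy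
  earlier∪last⊆ (inj₂ (refl , Rxy)) = ≤-refl , Rxy
  ⊆earlier∪last : (uncurry λ x y → x < suc a × R x y) ⊆ Earlier ∪ Last
  ⊆earlier∪last (s≤s x≤a , Rxy) with ℕ.m≤n⇒m<n∨m≡n x≤a
  ... | inj₁ x<a = inj₁ (x<a , Rxy)
  ... | inj₂ x≡a = inj₂ (x≡a , Rxy)

least : ∀ {P : Pred ℕ 0ℓ} → Decidable P → ∀ n → P n →
        ∃ λ m → P m × m ≤ n × (∀ {k} → k < m → ¬ P k)
least {P} P? = <-rec _ step
  where
  step : ∀ n → (∀ {k} → k < n → P k → ∃ λ m → P m × m ≤ k × (∀ {j} → j < m → ¬ P j)) →
         P n → ∃ λ m → P m × m ≤ n × (∀ {j} → j < m → ¬ P j)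
  step n below Pn with ℕ.anyUpTo? P? n
  ... | no none = n , Pn , ≤-refl , λ k<n Pk → none (_ , k<n , Pk)
  ... | yes (k , k<n , Pk) =
    let m , Pm , m≤k , minimal = below k<n Pk in m , Pm , ≤-trans m≤k (ℕ.<⇒≤ k<n) , minimal

≤-slack : ∀ {m n} k → m + k ≡ n → m ≤ n
≤-slack {m} k refl = ℕ.m≤m+n m k

∣-∣≤ : ∀ {m n e} → m ≤ n + e → n ≤ m + e → ∣ m - n ∣ ≤ e
∣-∣≤ {m} {n} m≤n+e n≤m+e with ℕ.∣m-n∣≡[m∸n]∨[n∸m] m n
... | inj₁ eq = subst (_≤ _) (sym eq) (ℕ.m≤n+o⇒m∸n≤o m n m≤n+e)
... | inj₂ eq = subst (_≤ _) (sym eq) (ℕ.m≤n+o⇒m∸n≤o n m n≤m+e)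

x≤2*x : ∀ x → x ≤ 2 * x
x≤2*x x = ℕ.m≤m+n x (x + 0)

2*x≤m+n : ∀ {x m n} → x ≤ m → x ≤ n → 2 * x ≤ m + n
2*x≤m+n {x} x≤m x≤n = ℕ.+-mono-≤ x≤m (subst (_≤ _) (sym (ℕ.+-identityʳ x)) x≤n)

m+n≡o⇒m<o : ∀ {m n o} → 0 < n → m + n ≡ o → m < o
m+n≡o⇒m<o {m} {n} 0<n refl = subst (_≤ m + n) (ℕ.+-comm m 1) (ℕ.+-monoʳ-≤ m 0<n)

<⇒≡suc : ∀ {m n} → m < n → ∃ λ n′ → n ≡ suc n′ × m ≤ n′
<⇒≡suc (s≤s m≤n′) = _ , refl , m≤n′

cancel-⇔ : ∀ {l r a b} k → l ≡ a + k → r ≡ b + k → (l ≡ r) ⇔ (a ≡ b)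
cancel-⇔ {a = a} {b} k l≡a+k r≡b+k = mk⇔
  (λ l≡r → ℕ.+-cancelʳ-≡ k a b (trans (sym l≡a+k) (trans l≡r r≡b+k)))
  (λ a≡b → trans l≡a+k (trans (cong (_+ k) a≡b) (sym r≡b+k)))

2*x≡1+y⇒x≤y : ∀ {x y} → 2 * x ≡ suc y → x ≤ y
2*x≡1+y⇒x≤y {suc x} {y} 2x≡1+y = ℕ.≤-pred (begin
  suc (suc x)    ≤⟨ s≤s (ℕ.m≤n+m (suc x) x) ⟩
  suc (x + suc x) ≡⟨ cong (λ k → suc (x + suc k)) (ℕ.+-identityʳ x) ⟨
  2 * suc x       ≡⟨ 2x≡1+y ⟩
  suc y           ∎)
  where open ≤-Reasoning

2*y≡1+x⇒0<y : ∀ {x y} → 2 * y ≡ suc x → 0 < y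
2*y≡1+x⇒0<y {y = suc y} _ = s≤s z≤n

3*≤-from-pred : ∀ {d} y → (∀ {y′} → y ≡ suc y′ → 2 + 3 * y′ < d) → 3 * y ≤ d
3*≤-from-pred zero _ = z≤n
3*≤-from-pred {d} (suc y′) 2+3y′<d = subst (_≤ d) (sym (ℕ.*-suc 3 y′)) (2+3y′<d refl)

module _ (x y : ℕ) where

  2*[x+y]≡3*y⇔ : (2 * (x + y) ≡ 3 * y) ⇔ (2 * x ≡ y)
  2*[x+y]≡3*y⇔ = cancel-⇔ (2 * y) (ℕ.*-distribˡ-+ 2 x y) refl

  2*[x+y]≡3*y+1⇔ : (2 * (x + y) ≡ 3 * y + 1) ⇔ (2 * x ≡ suc y)
  2*[x+y]≡3*y+1⇔ = cancel-⇔ (2 * y) (ℕ.*-distribˡ-+ 2 x y) (ℕ.+-comm (3 * y) 1)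

  2*[1+x+y]≡2+3*x⇔ : (2 * (suc x + y) ≡ 2 + 3 * x) ⇔ (2 * y ≡ x)
  2*[1+x+y]≡2+3*x⇔ = cancel-⇔ (2 + 2 * x) (lhs x y) (rhs x)
    where
    lhs : ∀ x y → 2 * (suc x + y) ≡ 2 * y + (2 + 2 * x)
    lhs = solve-∀
    rhs : ∀ x → 2 + 3 * x ≡ x + (2 + 2 * x)
    rhs = solve-∀

  2*[1+x+y]≡2+3*x+1⇔ : (2 * (suc x + y) ≡ 2 + 3 * x + 1) ⇔ (2 * y ≡ suc x)
  2*[1+x+y]≡2+3*x+1⇔ = cancel-⇔ (2 + 2 * x) (lhs x y) (rhs x)
    where
    lhs : ∀ x y → 2 * (suc x + y) ≡ 2 * y + (2 + 2 * x)
    lhs = solve-∀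
    rhs : ∀ x → 2 + 3 * x + 1 ≡ suc x + (2 + 2 * x)
    rhs = solve-∀

⌊n/2⌋≤m⇔n≤1+2*m : ∀ n m → (⌊ n /2⌋ ≤ m) ⇔ (n ≤ suc (2 * m))
⌊n/2⌋≤m⇔n≤1+2*m n m = mk⇔ (forth n m) (back n m)
  where
  forth : ∀ n m → ⌊ n /2⌋ ≤ m → n ≤ suc (2 * m)
  forth zero m _ = z≤n
  forth (suc zero) m _ = s≤s z≤n
  forth (suc (suc n)) (suc m) (s≤s h≤m) =
    subst (suc (suc n) ≤_) (cong suc (sym (ℕ.*-suc 2 m))) (s≤s (s≤s (forth n m h≤m)))
  back : ∀ n m → n ≤ suc (2 * m) → ⌊ n /2⌋ ≤ m
  back zero m _ = z≤n
  back (suc zero) m _ = z≤n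
  back (suc (suc n)) zero (s≤s ())
  back (suc (suc n)) (suc m) n≤1+2m =
    s≤s (back n m (ℕ.≤-pred (ℕ.≤-pred (subst (suc (suc n) ≤_) (cong suc (ℕ.*-suc 2 m)) n≤1+2m))))

m≤⌊n/2⌋⇔2*m≤n : ∀ m n → (m ≤ ⌊ n /2⌋) ⇔ (2 * m ≤ n)
m≤⌊n/2⌋⇔2*m≤n m n = mk⇔ (forth m n) (back m n)
  where
  forth : ∀ m n → m ≤ ⌊ n /2⌋ → 2 * m ≤ n
  forth zero n _ = z≤n
  forth (suc m) (suc (suc n)) (s≤s m≤h) = subst (_≤ suc (suc n)) (sym (ℕ.*-suc 2 m)) (s≤s (s≤s (forth m n m≤h)))
  back : ∀ m n → 2 * m ≤ n → m ≤ ⌊ n /2⌋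
  back zero n _ = z≤n
  back (suc m) n 2m≤n with subst (_≤ n) (ℕ.*-suc 2 m) 2m≤n
  ... | s≤s (s≤s 2m≤n′) = s≤s (back m _ 2m≤n′)

2*⌊n/2⌋≤n : ∀ n → 2 * ⌊ n /2⌋ ≤ n
2*⌊n/2⌋≤n n = to (m≤⌊n/2⌋⇔2*m≤n ⌊ n /2⌋ n) ≤-refl

n≤1+2*⌊n/2⌋ : ∀ n → n ≤ suc (2 * ⌊ n /2⌋)
n≤1+2*⌊n/2⌋ n = to (⌊n/2⌋≤m⇔n≤1+2*m n ⌊ n /2⌋) ≤-refl

<⌊n/2⌋⇔1+2*t<n : ∀ t n → (t < ⌊ n /2⌋) ⇔ (suc (2 * t) < n)
<⌊n/2⌋⇔1+2*t<n t n = mk⇔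
  (λ t<h → subst (_≤ n) (ℕ.*-suc 2 t) (to (m≤⌊n/2⌋⇔2*m≤n (suc t) n) t<h))
  (λ 1+2t<n → from (m≤⌊n/2⌋⇔2*m≤n (suc t) n) (subst (_≤ n) (sym (ℕ.*-suc 2 t)) 1+2t<n))

⌊1+2*t/2⌋≤t : ∀ t → ⌊ suc (2 * t) /2⌋ ≤ t
⌊1+2*t/2⌋≤t t = from (⌊n/2⌋≤m⇔n≤1+2*m (suc (2 * t)) t) ≤-refl

t<1+2*[1+2*t] : ∀ t → t < suc (2 * suc (2 * t))
t<1+2*[1+2*t] t = s≤s (≤-trans (ℕ.m≤n⇒m≤1+n (x≤2*x t)) (x≤2*x (suc (2 * t))))

Σ<-*ˡ : ∀ k f b → Σ< b (λ x → k * f x) ≡ k * Σ< b f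
Σ<-*ˡ k f zero = sym (ℕ.*-zeroʳ k)
Σ<-*ˡ k f (suc b) = trans (cong (_+ k * f b) (Σ<-*ˡ k f b)) (sym (ℕ.*-distribˡ-+ k (Σ< b f) (f b)))

odd-sum-step : ∀ c α b → c * (suc b * suc b) + α * suc b ≡ (c * (b * b) + α * b) + (c * suc (2 * b) + α)
odd-sum-step = solve-∀

-- Σ_{x<b} (2x+1) = b².
Σ<-lower : ∀ {f} c α → (∀ x → c * suc (2 * x) + α ≤ f x) → ∀ b → c * (b * b) + α * b ≤ Σ< b f
Σ<-lower c α f-bound zero = ℕ.≤-reflexive (cong₂ _+_ (ℕ.*-zeroʳ c) (ℕ.*-zeroʳ α))
Σ<-lower {f} c α f-bound (suc b) =
  subst (_≤ Σ< (suc b) f) (sym (odd-sum-step c α b)) (ℕ.+-mono-≤ (Σ<-lower c α f-bound b) (f-bound b))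

Σ<-upper : ∀ {f} c β → (∀ x → f x ≤ c * suc (2 * x) + β) → ∀ b → Σ< b f ≤ c * (b * b) + β * b
Σ<-upper c β f-bound zero = z≤n
Σ<-upper {f} c β f-bound (suc b) =
  subst (Σ< (suc b) f ≤_) (sym (odd-sum-step c β b)) (ℕ.+-mono-≤ (Σ<-upper c β f-bound b) (f-bound b))

row-bounds : ∀ c n → ⌊ n /2⌋ ≤ c →
             12 * c ≤ 12 * (c ∸ ⌊ n /2⌋) + 6 * n × 12 * (c ∸ ⌊ n /2⌋) + 6 * n ≤ 12 * c + 6
row-bounds c n h≤c = lower , upper
  where
  h : ℕ
  h = ⌊ n /2⌋
  split : 12 * c ≡ 12 * (c ∸ h) + 6 * (2 * h)
  split = begin
    12 * c                         ≡⟨ cong (12 *_) (ℕ.m∸n+n≡m h≤c) ⟨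
    12 * (c ∸ h + h)               ≡⟨ ℕ.*-distribˡ-+ 12 (c ∸ h) h ⟩
    12 * (c ∸ h) + 12 * h          ≡⟨ cong (λ k → 12 * (c ∸ h) + k) (ℕ.*-assoc 6 2 h) ⟩
    12 * (c ∸ h) + 6 * (2 * h)     ∎
    where open ≡-Reasoning
  lower : 12 * c ≤ 12 * (c ∸ h) + 6 * n
  lower = subst (_≤ 12 * (c ∸ h) + 6 * n) (sym split)
                (ℕ.+-monoʳ-≤ (12 * (c ∸ h)) (ℕ.*-monoʳ-≤ 6 (2*⌊n/2⌋≤n n)))
  upper : 12 * (c ∸ h) + 6 * n ≤ 12 * c + 6
  upper = begin
    12 * (c ∸ h) + 6 * n                 ≤⟨ ℕ.+-monoʳ-≤ (12 * (c ∸ h)) (ℕ.*-monoʳ-≤ 6 (n≤1+2*⌊n/2⌋ n)) ⟩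
    12 * (c ∸ h) + 6 * suc (2 * h)       ≡⟨ cong (λ k → 12 * (c ∸ h) + k) (ℕ.*-suc 6 (2 * h)) ⟩
    12 * (c ∸ h) + (6 + 6 * (2 * h))     ≡⟨ cong (λ k → 12 * (c ∸ h) + k) (ℕ.+-comm 6 (6 * (2 * h))) ⟩
    12 * (c ∸ h) + (6 * (2 * h) + 6)     ≡⟨ ℕ.+-assoc (12 * (c ∸ h)) (6 * (2 * h)) 6 ⟨
    12 * (c ∸ h) + 6 * (2 * h) + 6       ≡⟨ cong (_+ 6) split ⟨
    12 * c + 6                           ∎
    where open ≤-Reasoning

shift-estimate : ∀ {m N d e s} k → m ≤ N → N ≤ m + d → ∣ N * k - s ∣ ≤ e → ∣ m * k - s ∣ ≤ d * k + e
shift-estimate {m} {N} {d} {e} {s} k m≤N N≤m+d close = begin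
  ∣ m * k - s ∣                      ≤⟨ ℕ.∣-∣-triangle (m * k) (N * k) s ⟩
  ∣ m * k - N * k ∣ + ∣ N * k - s ∣   ≡⟨ cong (_+ ∣ N * k - s ∣) (ℕ.*-distribʳ-∣-∣ k m N) ⟨
  ∣ m - N ∣ * k + ∣ N * k - s ∣       ≤⟨ ℕ.+-mono-≤ (ℕ.*-monoˡ-≤ k ∣m-N∣≤d) close ⟩
  d * k + e                          ∎
  where
  open ≤-Reasoning
  ∣m-N∣≤d : ∣ m - N ∣ ≤ d
  ∣m-N∣≤d = subst (_≤ d) (sym (ℕ.m≤n⇒∣m-n∣≡n∸m m≤N)) (ℕ.m≤n+o⇒m∸n≤o N m N≤m+d)

half-estimate : ∀ k m q → q ≤ 2 * k + m + 1 → 2 * k + m ≤ q + 2 → ∣ (k + ⌊ m /2⌋) * 2 - q ∣ ≤ 2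
half-estimate k m q q≤2k+m+1 2k+m≤q+2 = ∣-∣≤
  (subst (_≤ q + 2) (sym (doubled k h)) (≤-trans (ℕ.+-monoʳ-≤ (2 * k) (2*⌊n/2⌋≤n m)) 2k+m≤q+2))
  (≤-trans q≤2k+m+1 (subst (2 * k + m + 1 ≤_) (doubled′ k h)
    (ℕ.+-monoˡ-≤ 1 (ℕ.+-monoʳ-≤ (2 * k) (n≤1+2*⌊n/2⌋ m)))))
  where
  h : ℕ
  h = ⌊ m /2⌋
  doubled : ∀ k h → (k + h) * 2 ≡ 2 * k + 2 * h
  doubled = solve-∀
  doubled′ : ∀ k h → 2 * k + suc (2 * h) + 1 ≡ (k + h) * 2 + 2
  doubled′ = solve-∀

∣m⊖n∣≡∣m-n∣ : ∀ m n → ℤ.∣ m ⊖ n ∣ ≡ ∣ m - n ∣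
∣m⊖n∣≡∣m-n∣ m n with ℕ.≤-total m n
... | inj₁ m≤n = trans (ℤ.∣⊖∣-≤ m≤n) (sym (ℕ.m≤n⇒∣m-n∣≡n∸m m≤n))
... | inj₂ n≤m =
  trans (ℤ.∣m⊖n∣≡∣n⊖m∣ m n) (trans (ℤ.∣⊖∣-≤ n≤m) (sym (ℕ.m≤n⇒∣n-m∣≡n∸m n≤m)))

-- |n/s − a/b| = |nb − as|/(sb) ≤ e/(sb) < 1/(d+1) ≤ ε, computed in ℚᵘ where n/s − a/b is not normalised.
ratio-near : ∀ {n s a b e d k} .{c : Coprime (suc k) (suc d)} →
             ∣ n * suc b - a * s ∣ ≤ e → e * suc d < s * suc b →
             ℚ.∣ ratio n s ℚ.- + a / suc b ∣ ℚ.< mkℚ (+ suc k) d c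
ratio-near {s = zero} _ ()
ratio-near {n} {suc s} {a} {b} {e} {d} {k} dist≤e e<sb =
  ℚ.toℚᵘ-cancel-< (ℚᵘ.<-respˡ-≃ (ℚᵘ.≃-sym toℚᵘ-dist)
    (*<* (subst₂ ℤ._<_ (sym lhs) (ℤ.pos-* (suc k) (suc s * suc b)) (ℤ.+<+ bound))))
  where
  toℚᵘ-dist : toℚᵘ (ℚ.∣ + n / suc s ℚ.- + a / suc b ∣) ℚᵘ.≃
              ℚᵘ.∣ mkℚᵘ (+ n) s ℚᵘ.- mkℚᵘ (+ a) b ∣
  toℚᵘ-dist = ℚᵘ.≃-trans (ℚ.toℚᵘ-homo-∣-∣ (+ n / suc s ℚ.- + a / suc b))
    (ℚᵘ.∣-∣-cong (ℚᵘ.≃-trans (ℚ.toℚᵘ-homo-+ (+ n / suc s) (ℚ.- (+ a / suc b)))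
      (ℚᵘ.+-cong (ℚ.toℚᵘ-fromℚᵘ (mkℚᵘ (+ n) s))
        (ℚᵘ.≃-trans (ℚ.toℚᵘ-homo‿- (+ a / suc b))
                    (ℚᵘ.-‿cong (ℚ.toℚᵘ-fromℚᵘ (mkℚᵘ (+ a) b)))))))
  numerator : + n ℤ.* + suc b ℤ.+ ℤ.- (+ a) ℤ.* + suc s ≡ (n * suc b) ⊖ (a * suc s)
  numerator = begin
    + n ℤ.* + suc b ℤ.+ ℤ.- (+ a) ℤ.* + suc s
      ≡⟨ cong₂ ℤ._+_ (sym (ℤ.pos-* n _)) (sym (ℤ.neg-distribˡ-* (+ a) _)) ⟩
    + (n * suc b) ℤ.+ ℤ.- (+ a ℤ.* + suc s)
      ≡⟨ cong (λ z → + (n * suc b) ℤ.+ ℤ.- z) (sym (ℤ.pos-* a _)) ⟩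
    + (n * suc b) ℤ.- + (a * suc s)
      ≡⟨ ℤ.m-n≡m⊖n (n * suc b) (a * suc s) ⟩
    (n * suc b) ⊖ (a * suc s)
      ∎
    where open ≡-Reasoning
  lhs : + ℤ.∣ + n ℤ.* + suc b ℤ.+ ℤ.- (+ a) ℤ.* + suc s ∣ ℤ.* + suc d ≡
        + (∣ n * suc b - a * suc s ∣ * suc d)
  lhs = trans (cong (λ z → + z ℤ.* + suc d)
                    (trans (cong ℤ.∣_∣ numerator) (∣m⊖n∣≡∣m-n∣ (n * suc b) (a * suc s))))
              (sym (ℤ.pos-* ∣ n * suc b - a * suc s ∣ (suc d)))
  bound : ∣ n * suc b - a * suc s ∣ * suc d < suc k * (suc s * suc b)
  bound = begin-strict
    ∣ n * suc b - a * suc s ∣ * suc d  ≤⟨ ℕ.*-monoˡ-≤ (suc d) dist≤e ⟩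
    e * suc d                          <⟨ e<sb ⟩
    suc s * suc b                      ≤⟨ ℕ.m≤n*m _ (suc k) ⟩
    suc k * (suc s * suc b)            ∎
    where open ≤-Reasoning

limit-from-estimate : ∀ (R : ℕ → ℕ → Set) (scale err : ℕ → ℕ) b →
  (∀ q → Coprime 3 q → ∃ λ n → R q n × ∣ n * suc b - scale q ∣ ≤ err q) →
  (∀ d → ∃ λ Q → ∀ q → Q ≤ q → err q * suc d < scale q * suc b) →
  LimitPrimeTo3 R scale (+ 1 / suc b)
limit-from-estimate R scale err b estimate negligible (mkℚ (+ zero) d c) (ℚ.*<* (ℤ.+<+ ()))
limit-from-estimate R scale err b estimate negligible (mkℚ -[1+ _ ] d c) (ℚ.*<* ())
limit-from-estimate R scale err b estimate negligible (mkℚ (+ suc k) d c) _ with negligible d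
... | Q , beyond = Q , λ q Q≤q q⊥3 → let n , Rqn , close = estimate q q⊥3 in
    n , Rqn , ratio-near {n} {scale q} {1} {b} {err q} {d} {k} {c}
                (subst (λ s → ∣ n * suc b - s ∣ ≤ err q) (sym (ℕ.*-identityˡ (scale q))) close) (beyond q Q≤q)

linear-negligible-vs-square : ∀ c b d → ∃ λ Q → ∀ q → Q ≤ q → c * q * suc d < q * q * suc b
linear-negligible-vs-square c b d = suc (c * suc d) , beyond
  where
  beyond : ∀ q → suc (c * suc d) ≤ q → c * q * suc d < q * q * suc b
  beyond q@(suc _) c[1+d]<q = begin-strict
    c * q * suc d      ≡⟨ ℕ.*-assoc c q (suc d) ⟩
    c * (q * suc d)    ≡⟨ cong (c *_) (ℕ.*-comm q (suc d)) ⟩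
    c * (suc d * q)    ≡⟨ ℕ.*-assoc c (suc d) q ⟨
    c * suc d * q      <⟨ ℕ.*-monoˡ-< q c[1+d]<q ⟩
    q * q              ≤⟨ ℕ.m≤m*n (q * q) (suc b) ⟩
    q * q * suc b      ∎
    where open ≤-Reasoning

constant-negligible-vs-linear : ∀ c b d → ∃ λ Q → ∀ q → Q ≤ q → c * suc d < q * suc b
constant-negligible-vs-linear c b d = suc (c * suc d) , λ q c[1+d]<q → ℕ.<-≤-trans c[1+d]<q (ℕ.m≤m*n q (suc b))

-- Residues modulo 3

data Residue3 : ℕ → Set where
  mod0 : ∀ m → Residue3 (3 * m)
  mod1 : ∀ m → Residue3 (1 + 3 * m)
  mod2 : ∀ m → Residue3 (2 + 3 * m)

residue3 : ∀ n → Residue3 n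
residue3 zero = mod0 0
residue3 (suc n) with residue3 n
... | mod0 m = mod1 m
... | mod1 m = mod2 m
... | mod2 m = subst Residue3 (ℕ.*-suc 3 m) (mod0 (suc m))

residue-cong : ∀ {r s a b} → r + 3 * a ≡ s + 3 * b → r % 3 ≡ s % 3
residue-cong {r} {s} {a} {b} eq = begin
  r % 3              ≡⟨ [m+kn]%n≡m%n r a 3 ⟨
  (r + a * 3) % 3    ≡⟨ cong (λ k → (r + k) % 3) (ℕ.*-comm a 3) ⟩
  (r + 3 * a) % 3    ≡⟨ cong (_% 3) eq ⟩
  (s + 3 * b) % 3    ≡⟨ cong (λ k → (s + k) % 3) (ℕ.*-comm 3 b) ⟩
  (s + b * 3) % 3    ≡⟨ [m+kn]%n≡m%n s b 3 ⟩
  s % 3              ∎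
  where open ≡-Reasoning

3*-injective : ∀ {a b} → 3 * a ≡ 3 * b → a ≡ b
3*-injective {a} {b} = ℕ.*-cancelˡ-≡ a b 3

3*x≤r+3*m⇒x≤m : ∀ {x m} r → r < 3 → 3 * x ≤ r + 3 * m → x ≤ m
3*x≤r+3*m⇒x≤m {x} {m} r r<3 3x≤r+3m = ℕ.≮⇒≥ λ m<x → ℕ.<-irrefl refl (begin-strict
  r + 3 * m    <⟨ ℕ.+-monoˡ-< (3 * m) r<3 ⟩
  3 + 3 * m    ≡⟨ ℕ.*-suc 3 m ⟨
  3 * suc m    ≤⟨ ℕ.*-monoʳ-≤ 3 m<x ⟩
  3 * x        ≤⟨ 3x≤r+3m ⟩
  r + 3 * m    ∎)
  where open ≤-Reasoning

[r+3*x]+3*[m∸x]≡r+3*m : ∀ r {x m} → x ≤ m → (r + 3 * x) + 3 * (m ∸ x) ≡ r + 3 * m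
[r+3*x]+3*[m∸x]≡r+3*m r {x} {m} x≤m = begin
  (r + 3 * x) + 3 * (m ∸ x)  ≡⟨ ℕ.+-assoc r (3 * x) (3 * (m ∸ x)) ⟩
  r + (3 * x + 3 * (m ∸ x))  ≡⟨ cong (r ℕ.+_) (ℕ.*-distribˡ-+ 3 x (m ∸ x)) ⟨
  r + 3 * (x + (m ∸ x))      ≡⟨ cong (λ k → r + 3 * k) (ℕ.m+[n∸m]≡n x≤m) ⟩
  r + 3 * m                  ∎
  where open ≡-Reasoning

twice-1+3* : ∀ x → (1 + 3 * x) + (1 + 3 * x) ≡ 2 + 3 * (2 * x)
twice-1+3* = solve-∀

twice-2+3* : ∀ y → (2 + 3 * y) + (2 + 3 * y) ≡ 1 + 3 * suc (2 * y)
twice-2+3* = solve-∀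

coprime-to-3 : ∀ {q} → Coprime 3 q → (∃ λ a → q ≡ 1 + 3 * a) ⊎ (∃ λ a → q ≡ 2 + 3 * a)
coprime-to-3 {q} 3⊥q with residue3 q
... | mod0 m = contradiction (3⊥q (∣-refl , m∣m*n m)) λ ()
... | mod1 m = inj₁ (m , refl)
... | mod2 m = inj₂ (m , refl)

coprime-to-3⇒0<q : ∀ {q} → Coprime 3 q → 0 < q
coprime-to-3⇒0<q {zero} 3⊥0 = contradiction (3⊥0 (∣-refl , 3 ∣0)) λ ()
coprime-to-3⇒0<q {suc q} _ = s≤s z≤n

-- Kunz coordinates

-- The set {3m} ∪ {3m+1 | x ≤ m} ∪ {3m+2 | y ≤ m}; when y ≤ 2x and x ≤ 2y+1 it is the numerical
-- semigroup containing 3 with Apéry set {0, 3x+1, 3y+2}, and (x, y) are its Kunz coordinates.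
kunz : ℕ → ℕ → ℕ → Bool
kunz x y 0 = true
kunz x y 1 = x ≤ᵇ 0
kunz x y 2 = y ≤ᵇ 0
kunz x y (suc (suc (suc n))) = kunz (pred x) (pred y) n

Kunz : ℕ → ℕ → Pred ℕ 0ℓ
Kunz x y n = kunz x y n ≡ true

pred≤ᵇ : ∀ x m → (pred x ≤ᵇ m) ≡ (x ≤ᵇ suc m)
pred≤ᵇ zero m = refl
pred≤ᵇ (suc zero) m = refl
pred≤ᵇ (suc (suc x)) m = refl

kunz-3* : ∀ x y m → Kunz x y (3 * m)
kunz-3* x y zero = refl
kunz-3* x y (suc m) = subst (Kunz x y) (sym (ℕ.*-suc 3 m)) (kunz-3* (pred x) (pred y) m)

kunz-1+3* : ∀ x y m → kunz x y (1 + 3 * m) ≡ (x ≤ᵇ m)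
kunz-1+3* x y zero = refl
kunz-1+3* x y (suc m) = begin
  kunz x y (1 + 3 * suc m)             ≡⟨ cong (λ k → kunz x y (1 + k)) (ℕ.*-suc 3 m) ⟩
  kunz (pred x) (pred y) (1 + 3 * m)   ≡⟨ kunz-1+3* (pred x) (pred y) m ⟩
  (pred x ≤ᵇ m)                        ≡⟨ pred≤ᵇ x m ⟩
  (x ≤ᵇ suc m)                         ∎
  where open ≡-Reasoning

kunz-2+3* : ∀ x y m → kunz x y (2 + 3 * m) ≡ (y ≤ᵇ m)
kunz-2+3* x y zero = refl
kunz-2+3* x y (suc m) = begin
  kunz x y (2 + 3 * suc m)             ≡⟨ cong (λ k → kunz x y (2 + k)) (ℕ.*-suc 3 m) ⟩
  kunz (pred x) (pred y) (2 + 3 * m)   ≡⟨ kunz-2+3* (pred x) (pred y) m ⟩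
  (pred y ≤ᵇ m)                        ≡⟨ pred≤ᵇ y m ⟩
  (y ≤ᵇ suc m)                         ∎
  where open ≡-Reasoning

Kunz-1+3*⁺ : ∀ x y m → x ≤ m → Kunz x y (1 + 3 * m)
Kunz-1+3*⁺ x y m x≤m = trans (kunz-1+3* x y m) (to T-≡ (ℕ.≤⇒≤ᵇ x≤m))

Kunz-1+3*⁻ : ∀ x y m → Kunz x y (1 + 3 * m) → x ≤ m
Kunz-1+3*⁻ x y m 1+3m∈ = ℕ.≤ᵇ⇒≤ x m (from T-≡ (trans (sym (kunz-1+3* x y m)) 1+3m∈))

Kunz-2+3*⁺ : ∀ x y m → y ≤ m → Kunz x y (2 + 3 * m)
Kunz-2+3*⁺ x y m y≤m = trans (kunz-2+3* x y m) (to T-≡ (ℕ.≤⇒≤ᵇ y≤m))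

Kunz-2+3*⁻ : ∀ x y m → Kunz x y (2 + 3 * m) → y ≤ m
Kunz-2+3*⁻ x y m 2+3m∈ = ℕ.≤ᵇ⇒≤ y m (from T-≡ (trans (sym (kunz-2+3* x y m)) 2+3m∈))

Kunz-≥ : ∀ {x y n} → 3 * x ≤ n → 3 * y ≤ n → Kunz x y n
Kunz-≥ {x} {y} {n} 3x≤n 3y≤n with residue3 n
... | mod0 m = kunz-3* x y m
... | mod1 m = Kunz-1+3*⁺ x y m (3*x≤r+3*m⇒x≤m 1 (s≤s (s≤s z≤n)) 3x≤n)
... | mod2 m = Kunz-2+3*⁺ x y m (3*x≤r+3*m⇒x≤m 2 (s≤s (s≤s (s≤s z≤n))) 3y≤n)

Kunz-regroup : ∀ {x y} r s m n → Kunz x y ((r + s) + 3 * (m + n)) → Kunz x y ((r + 3 * m) + (s + 3 * n))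
Kunz-regroup {x} {y} r s m n = subst (Kunz x y) (sym (regroup r s m n))
  where
  regroup : ∀ r s m n → (r + 3 * m) + (s + 3 * n) ≡ (r + s) + 3 * (m + n)
  regroup = solve-∀

kunz-closed : ∀ {x y} → y ≤ 2 * x → x ≤ suc (2 * y) → ∀ a b → Kunz x y a → Kunz x y b → Kunz x y (a + b)
kunz-closed {x} {y} y≤2x x≤1+2y a b a∈ b∈ with residue3 a | residue3 b
... | mod0 m | mod0 n = Kunz-regroup 0 0 m n (kunz-3* x y (m + n))
... | mod0 m | mod1 n = Kunz-regroup 0 1 m n (Kunz-1+3*⁺ x y (m + n) (ℕ.m≤n⇒m≤o+n m (Kunz-1+3*⁻ x y n b∈)))
... | mod0 m | mod2 n = Kunz-regroup 0 2 m n (Kunz-2+3*⁺ x y (m + n) (ℕ.m≤n⇒m≤o+n m (Kunz-2+3*⁻ x y n b∈)))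
... | mod1 m | mod0 n = Kunz-regroup 1 0 m n (Kunz-1+3*⁺ x y (m + n) (ℕ.m≤n⇒m≤n+o n (Kunz-1+3*⁻ x y m a∈)))
... | mod2 m | mod0 n = Kunz-regroup 2 0 m n (Kunz-2+3*⁺ x y (m + n) (ℕ.m≤n⇒m≤n+o n (Kunz-2+3*⁻ x y m a∈)))
... | mod1 m | mod2 n = Kunz-regroup 1 2 m n (kunz-3* (pred x) (pred y) (m + n))
... | mod2 m | mod1 n = Kunz-regroup 2 1 m n (kunz-3* (pred x) (pred y) (m + n))
... | mod1 m | mod1 n = Kunz-regroup 1 1 m n (Kunz-2+3*⁺ x y (m + n)
  (ℕ.≤-trans y≤2x (2*x≤m+n (Kunz-1+3*⁻ x y m a∈) (Kunz-1+3*⁻ x y n b∈))))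
... | mod2 m | mod2 n = Kunz-regroup 2 2 m n (Kunz-1+3*⁺ (pred x) (pred y) (m + n)
  (ℕ.pred-mono-≤ (ℕ.≤-trans x≤1+2y (s≤s (2*x≤m+n (Kunz-2+3*⁻ x y m a∈) (Kunz-2+3*⁻ x y n b∈))))))

Kunz-remove-1+3* : ∀ {x y n} → Kunz x y n → n ≢ 1 + 3 * x → Kunz (suc x) y n
Kunz-remove-1+3* {x} {y} {n} n∈ n≢ with residue3 n
... | mod0 m = kunz-3* (suc x) y m
... | mod1 m with ℕ.m≤n⇒m<n∨m≡n (Kunz-1+3*⁻ x y m n∈)
...   | inj₁ x<m = Kunz-1+3*⁺ (suc x) y m x<m
...   | inj₂ refl = contradiction refl n≢
Kunz-remove-1+3* {x} {y} {n} n∈ n≢ | mod2 m = Kunz-2+3*⁺ (suc x) y m (Kunz-2+3*⁻ x y m n∈)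

Kunz-remove-2+3* : ∀ {x y n} → Kunz x y n → n ≢ 2 + 3 * y → Kunz x (suc y) n
Kunz-remove-2+3* {x} {y} {n} n∈ n≢ with residue3 n
... | mod0 m = kunz-3* x (suc y) m
... | mod1 m = Kunz-1+3*⁺ x (suc y) m (Kunz-1+3*⁻ x y m n∈)
... | mod2 m with ℕ.m≤n⇒m<n∨m≡n (Kunz-2+3*⁻ x y m n∈)
...   | inj₁ y<m = Kunz-2+3*⁺ x (suc y) m y<m
...   | inj₂ refl = contradiction refl n≢

-- Removing 1 + 3x from the semigroup still leaves a semigroup (kunz (suc x) y) when x < 1 + 2y,
-- so 1 + 3x is not a sum of two of its positive elements.
1+3*-indecomposable : ∀ {x y a b} → y ≤ 2 * x → x < suc (2 * y) → 0 < a → 0 < b →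
                      Kunz x y a → Kunz x y b → a + b ≢ 1 + 3 * x
1+3*-indecomposable {x} {y} {a} {b} y≤2x x<1+2y 0<a 0<b a∈ b∈ a+b≡ = ℕ.<-irrefl refl
  (Kunz-1+3*⁻ (suc x) y x (subst (Kunz (suc x) y) a+b≡
    (kunz-closed (≤-trans y≤2x (ℕ.*-monoʳ-≤ 2 (ℕ.n≤1+n x))) x<1+2y a b
      (Kunz-remove-1+3* a∈ (ℕ.<⇒≢ (m+n≡o⇒m<o 0<b a+b≡)))
      (Kunz-remove-1+3* b∈ (ℕ.<⇒≢ (m+n≡o⇒m<o 0<a (trans (ℕ.+-comm b a) a+b≡)))))))

2+3*-indecomposable : ∀ {x y a b} → y < 2 * x → x ≤ suc (2 * y) → 0 < a → 0 < b →
                      Kunz x y a → Kunz x y b → a + b ≢ 2 + 3 * y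
2+3*-indecomposable {x} {y} {a} {b} y<2x x≤1+2y 0<a 0<b a∈ b∈ a+b≡ = ℕ.<-irrefl refl
  (Kunz-2+3*⁻ x (suc y) y (subst (Kunz x (suc y)) a+b≡
    (kunz-closed y<2x (≤-trans x≤1+2y (s≤s (ℕ.*-monoʳ-≤ 2 (ℕ.n≤1+n y)))) a b
      (Kunz-remove-2+3* a∈ (ℕ.<⇒≢ (m+n≡o⇒m<o 0<b a+b≡)))
      (Kunz-remove-2+3* b∈ (ℕ.<⇒≢ (m+n≡o⇒m<o 0<a (trans (ℕ.+-comm b a) a+b≡)))))))

kunz-injective : ∀ {x y x′ y′} → (∀ n → kunz x y n ≡ kunz x′ y′ n) → x ≡ x′ × y ≡ y′
kunz-injective {x} {y} {x′} {y′} same =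
  ℕ.≤-antisym (x≤ (sym ∘ same)) (x≤ same) , ℕ.≤-antisym (y≤ (sym ∘ same)) (y≤ same)
  where
  x≤ : ∀ {x y x′ y′} → (∀ n → kunz x y n ≡ kunz x′ y′ n) → x′ ≤ x
  x≤ {x} {y} {x′} {y′} same = Kunz-1+3*⁻ x′ y′ x (trans (sym (same (1 + 3 * x))) (Kunz-1+3*⁺ x y x ≤-refl))
  y≤ : ∀ {x y x′ y′} → (∀ n → kunz x y n ≡ kunz x′ y′ n) → y′ ≤ y
  y≤ {x} {y} {x′} {y′} same = Kunz-2+3*⁻ x′ y′ y (trans (sym (same (2 + 3 * y))) (Kunz-2+3*⁺ x y y ≤-refl))

-- Semigroups containing 3 and q

tabulateℕ : ∀ k → (ℕ → Bool) → Vec Bool k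
tabulateℕ zero f = []
tabulateℕ (suc k) f = f 0 ∷ tabulateℕ k (f ∘ suc)

mem-tabulateℕ : ∀ k f {n} → n < k → mem (tabulateℕ k f) n ≡ f n
mem-tabulateℕ (suc k) f {zero} _ = refl
mem-tabulateℕ (suc k) f {suc n} (s≤s n<k) = mem-tabulateℕ k (f ∘ suc) n<k

mem-≥ : ∀ {k} (v : Vec Bool k) {n} → k ≤ n → mem v n ≡ true
mem-≥ [] _ = refl
mem-≥ (b ∷ v) (s≤s k≤n) = mem-≥ v k≤n

mem-injective : ∀ {k} (v w : Vec Bool k) → (∀ n → mem v n ≡ mem w n) → v ≡ w
mem-injective [] [] _ = refl
mem-injective (b ∷ v) (c ∷ w) same = cong₂ _∷_ (same 0) (mem-injective v w (same ∘ suc))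

encode : ∀ q → ℕ → ℕ → Vec Bool (3 * q)
encode q x y = tabulateℕ (3 * q) (kunz x y)

-- x ≤ q and y ≤ q make the truncation to [0, 3q) in encode harmless; they follow from q∈ when 3 ∤ q.
record Admissible (q x y : ℕ) : Set where
  constructor admissible
  field
    y≤2x : y ≤ 2 * x
    x≤1+2y : x ≤ suc (2 * y)
    q∈ : Kunz x y q
    x≤q : x ≤ q
    y≤q : y ≤ q

mem-encode : ∀ {q x y} → x ≤ q → y ≤ q → ∀ n → mem (encode q x y) n ≡ kunz x y n
mem-encode {q} {x} {y} x≤q y≤q n with n ℕ.<? 3 * q
... | yes n<3q = mem-tabulateℕ (3 * q) (kunz x y) n<3q
... | no n≮3q = trans (mem-≥ (encode q x y) 3q≤n)
  (sym (Kunz-≥ (≤-trans (ℕ.*-monoʳ-≤ 3 x≤q) 3q≤n) (≤-trans (ℕ.*-monoʳ-≤ 3 y≤q) 3q≤n)))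
  where
  3q≤n : 3 * q ≤ n
  3q≤n = ℕ.≮⇒≥ n≮3q

module _ {q x y} (A : Admissible q x y) where
  open Admissible A

  encode⁺ : ∀ {n} → Kunz x y n → In (encode q x y) n
  encode⁺ {n} = trans (mem-encode x≤q y≤q n)

  encode⁻ : ∀ {n} → In (encode q x y) n → Kunz x y n
  encode⁻ {n} = trans (sym (mem-encode x≤q y≤q n))

  encode-SG : SG 3 q (encode q x y)
  encode-SG =
    (encode⁺ refl , (λ a b a∈ b∈ → encode⁺ (kunz-closed y≤2x x≤1+2y a b (encode⁻ a∈) (encode⁻ b∈))) ,
     3 * q , λ n → mem-≥ (encode q x y)) ,
    encode⁺ (kunz-3* x y 1) , encode⁺ q∈

encode-injective : ∀ {q x y x′ y′} → Admissible q x y → Admissible q x′ y′ →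
                   encode q x y ≡ encode q x′ y′ → (x , y) ≡ (x′ , y′)
encode-injective A A′ eq with kunz-injective (λ n →
  trans (sym (mem-encode (Admissible.x≤q A) (Admissible.y≤q A) n))
        (trans (cong (λ v → mem v n) eq) (mem-encode (Admissible.x≤q A′) (Admissible.y≤q A′) n)))
... | refl , refl = refl

-- The Kunz coordinates of H are the least t with 3t+1 ∈ H and the least t with 3t+2 ∈ H.
SG⇒encode : ∀ {q} (v : Vec Bool (3 * q)) → SG 3 q v → ∃₂ λ x y → Admissible q x y × encode q x y ≡ v
SG⇒encode {q} v ((0∈ , closed , _) , 3∈ , q∈) =
  x , y , admissible y≤2x x≤1+2y (In⇒Kunz q∈) x≤q y≤q ,
  mem-injective (encode q x y) v λ n → trans (mem-encode x≤q y≤q n) (⇔→≡ (mk⇔ Kunz⇒In In⇒Kunz))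
  where
  least-x : ∃ λ x → In v (1 + 3 * x) × x ≤ q × (∀ {t} → t < x → ¬ In v (1 + 3 * t))
  least-x = least (λ t → mem v (1 + 3 * t) Bool.≟ true) q (mem-≥ v (ℕ.n≤1+n (3 * q)))
  least-y : ∃ λ y → In v (2 + 3 * y) × y ≤ q × (∀ {t} → t < y → ¬ In v (2 + 3 * t))
  least-y = least (λ t → mem v (2 + 3 * t) Bool.≟ true) q (mem-≥ v (ℕ.m≤n+m (3 * q) 2))
  x y : ℕ
  x = proj₁ least-x
  y = proj₁ least-y
  1+3x∈ : In v (1 + 3 * x)
  1+3x∈ = proj₁ (proj₂ least-x)
  2+3y∈ : In v (2 + 3 * y)
  2+3y∈ = proj₁ (proj₂ least-y)
  x≤q : x ≤ q
  x≤q = proj₁ (proj₂ (proj₂ least-x))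
  y≤q : y ≤ q
  y≤q = proj₁ (proj₂ (proj₂ least-y))
  below-x : ∀ {t} → t < x → ¬ In v (1 + 3 * t)
  below-x = proj₂ (proj₂ (proj₂ least-x))
  below-y : ∀ {t} → t < y → ¬ In v (2 + 3 * t)
  below-y = proj₂ (proj₂ (proj₂ least-y))
  3*∈ : ∀ m → In v (3 * m)
  3*∈ zero = 0∈
  3*∈ (suc m) = subst (In v) (sym (ℕ.*-suc 3 m)) (closed 3 (3 * m) 3∈ (3*∈ m))
  In⇒Kunz : ∀ {n} → In v n → Kunz x y n
  In⇒Kunz {n} n∈ with residue3 n
  ... | mod0 m = kunz-3* x y m
  ... | mod1 m = Kunz-1+3*⁺ x y m (ℕ.≮⇒≥ λ m<x → below-x m<x n∈)
  ... | mod2 m = Kunz-2+3*⁺ x y m (ℕ.≮⇒≥ λ m<y → below-y m<y n∈)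
  Kunz⇒In : ∀ {n} → Kunz x y n → In v n
  Kunz⇒In {n} n∈ with residue3 n
  ... | mod0 m = 3*∈ m
  ... | mod1 m = subst (In v) ([r+3*x]+3*[m∸x]≡r+3*m 1 (Kunz-1+3*⁻ x y m n∈)) (closed _ _ 1+3x∈ (3*∈ (m ∸ x)))
  ... | mod2 m = subst (In v) ([r+3*x]+3*[m∸x]≡r+3*m 2 (Kunz-2+3*⁻ x y m n∈)) (closed _ _ 2+3y∈ (3*∈ (m ∸ y)))
  y≤2x : y ≤ 2 * x
  y≤2x = Kunz-2+3*⁻ x y (2 * x) (In⇒Kunz (subst (In v) (twice-1+3* x) (closed _ _ 1+3x∈ 1+3x∈)))
  x≤1+2y : x ≤ suc (2 * y)
  x≤1+2y = Kunz-1+3*⁻ x y (suc (2 * y)) (In⇒Kunz (subst (In v) (twice-2+3* y) (closed _ _ 2+3y∈ 2+3y∈)))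

CountIs-encode : ∀ {q n} {P : Pred (Vec Bool (3 * q)) 0ℓ} {C : ℕ → ℕ → Set} →
  (∀ {x y} → Admissible q x y → P (encode q x y) → C x y) →
  (∀ {x y} → Admissible q x y → C x y → P (encode q x y)) →
  CountIs (uncurry λ x y → Admissible q x y × C x y) n → CountIs (λ v → SG 3 q v × P v) n
CountIs-encode {q} {P = P} P⇒C C⇒P = CountIs-image (uncurry (encode q))
  (λ (A , _) (A′ , _) → encode-injective A A′)
  (λ (A , Cxy) → encode-SG A , C⇒P A Cxy)
  (λ {v} (sg , Pv) → let x , y , A , e = SG⇒encode v sg in (x , y) , (A , P⇒C A (subst P (sym e) Pv)) , e)

-- Genus, conductor and embedding dimension

IsConductor-unique : ∀ {H : Pred ℕ 0ℓ} {c c′} → IsConductor H c → IsConductor H c′ → c ≡ c′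
IsConductor-unique (above , least-c) (above′ , least-c′) = ℕ.≤-antisym (least-c _ above′) (least-c′ _ above)

SymmetricCoordinates : ℕ → ℕ → Set
SymmetricCoordinates x y = 2 * x ≡ y ⊎ x ≡ suc (2 * y)

PseudoSymmetricCoordinates : ℕ → ℕ → Set
PseudoSymmetricCoordinates x y = (2 * y ≡ x × 0 < y) ⊎ 2 * x ≡ suc y

MedimCoordinates : ℕ → ℕ → Set
MedimCoordinates x y = 0 < x × 0 < y × ¬ SymmetricCoordinates x y

module KunzSemigroup {x y : ℕ} {H : Pred ℕ 0ℓ}
                     (H⇒Kunz : ∀ {n} → H n → Kunz x y n) (Kunz⇒H : ∀ {n} → Kunz x y n → H n) where

  1+3*∉ : ∀ {t} → t < x → ¬ H (1 + 3 * t)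
  1+3*∉ {t} t<x t∈ = ℕ.<⇒≱ t<x (Kunz-1+3*⁻ x y t (H⇒Kunz t∈))

  2+3*∉ : ∀ {t} → t < y → ¬ H (2 + 3 * t)
  2+3*∉ {t} t<y t∈ = ℕ.<⇒≱ t<y (Kunz-2+3*⁻ x y t (H⇒Kunz t∈))

  genus : Genus H (x + y)
  genus = CountIs-cong gaps⊆ ⊆gaps (CountIs-∪ disjoint
    (CountIs-Range (3*-injective ∘ ℕ.suc-injective))
    (CountIs-Range (3*-injective ∘ ℕ.suc-injective ∘ ℕ.suc-injective)))
    where
    disjoint : ∀ {n} → Range (λ t → 1 + 3 * t) x n → ¬ Range (λ t → 2 + 3 * t) y n
    disjoint (s , _ , 1+3s≡n) (t , _ , 2+3t≡n) =
      contradiction (residue-cong {1} {2} {s} {t} (trans 1+3s≡n (sym 2+3t≡n))) λ ()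
    gaps⊆ : Range (λ t → 1 + 3 * t) x ∪ Range (λ t → 2 + 3 * t) y ⊆ λ n → ¬ H n
    gaps⊆ (inj₁ (t , t<x , refl)) = 1+3*∉ t<x
    gaps⊆ (inj₂ (t , t<y , refl)) = 2+3*∉ t<y
    ⊆gaps : (λ n → ¬ H n) ⊆ Range (λ t → 1 + 3 * t) x ∪ Range (λ t → 2 + 3 * t) y
    ⊆gaps {n} n∉ with residue3 n
    ... | mod0 m = ⊥-elim (n∉ (Kunz⇒H (kunz-3* x y m)))
    ... | mod1 m with x ℕ.≤? m
    ...   | yes x≤m = ⊥-elim (n∉ (Kunz⇒H (Kunz-1+3*⁺ x y m x≤m)))
    ...   | no x≰m = inj₁ (m , ℕ.≰⇒> x≰m , refl)
    ⊆gaps {n} n∉ | mod2 m with y ℕ.≤? m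
    ...   | yes y≤m = ⊥-elim (n∉ (Kunz⇒H (Kunz-2+3*⁺ x y m y≤m)))
    ...   | no y≰m = inj₂ (m , ℕ.≰⇒> y≰m , refl)

  gap<conductor : ∀ {d g} → (∀ n → d ≤ n → H n) → ¬ H g → g < d
  gap<conductor above g∉ = ℕ.≰⇒> λ d≤g → g∉ (above _ d≤g)

  conductor-≤ : x ≤ y → IsConductor H (3 * y)
  conductor-≤ x≤y =
    (λ n 3y≤n → Kunz⇒H (Kunz-≥ (≤-trans (ℕ.*-monoʳ-≤ 3 x≤y) 3y≤n) 3y≤n)) , least-conductor
    where
    least-conductor : ∀ d → (∀ n → d ≤ n → H n) → 3 * y ≤ d
    least-conductor d above =
      3*≤-from-pred y λ y≡1+y′ → gap<conductor above (2+3*∉ (ℕ.≤-reflexive (sym y≡1+y′)))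

  conductor-> : ∀ {x′} → x ≡ suc x′ → y ≤ x′ → IsConductor H (2 + 3 * x′)
  conductor-> {x′} x≡ y≤x′ = above , λ d above′ → gap<conductor above′ (1+3*∉ (ℕ.≤-reflexive (sym x≡)))
    where
    above : ∀ n → 2 + 3 * x′ ≤ n → H n
    above n 2+3x′≤n with residue3 n
    ... | mod0 m = Kunz⇒H (kunz-3* x y m)
    ... | mod1 m = Kunz⇒H (Kunz-1+3*⁺ x y m (3*x≤r+3*m⇒x≤m 2 (s≤s (s≤s (s≤s z≤n)))
                     (subst (_≤ 2 + 3 * m) (sym (trans (cong (3 *_) x≡) (ℕ.*-suc 3 x′))) (s≤s 2+3x′≤n))))
    ... | mod2 m =
      Kunz⇒H (Kunz-2+3*⁺ x y m (≤-trans y≤x′ (ℕ.*-cancelˡ-≤ 3 (ℕ.+-cancelˡ-≤ 2 _ _ 2+3x′≤n))))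

  Symmetric⇒ : Symmetric H → SymmetricCoordinates x y
  Symmetric⇒ (g , c , G , C , 2g≡c) with CountIs-unique genus G | x ℕ.≤? y
  ... | refl | yes x≤y with IsConductor-unique (conductor-≤ x≤y) C
  ...   | refl = inj₁ (to (2*[x+y]≡3*y⇔ x y) 2g≡c)
  Symmetric⇒ (g , c , G , C , 2g≡c) | refl | no x≰y with <⇒≡suc (ℕ.≰⇒> x≰y)
  ... | x′ , x≡1+x′ , y≤x′ with IsConductor-unique (conductor-> x≡1+x′ y≤x′) C
  ...   | refl = inj₂ (trans x≡1+x′ (cong suc (sym (to (2*[1+x+y]≡2+3*x⇔ x′ y)
                   (subst (λ x → 2 * (x + y) ≡ 2 + 3 * x′) x≡1+x′ 2g≡c)))))

  Symmetric⇐ : SymmetricCoordinates x y → Symmetric H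
  Symmetric⇐ (inj₁ 2x≡y) = x + y , 3 * y , genus , conductor-≤ (subst (x ≤_) 2x≡y (x≤2*x x)) ,
    from (2*[x+y]≡3*y⇔ x y) 2x≡y
  Symmetric⇐ (inj₂ x≡1+2y) = x + y , 2 + 3 * (2 * y) , genus , conductor-> x≡1+2y (x≤2*x y) ,
    subst (λ x → 2 * (x + y) ≡ 2 + 3 * (2 * y)) (sym x≡1+2y) (from (2*[1+x+y]≡2+3*x⇔ (2 * y) y) refl)

  PseudoSymmetric⇒ : PseudoSymmetric H → PseudoSymmetricCoordinates x y
  PseudoSymmetric⇒ (g , c , G , C , 2g≡c+1) with CountIs-unique genus G | x ℕ.≤? y
  ... | refl | yes x≤y with IsConductor-unique (conductor-≤ x≤y) C
  ...   | refl = inj₂ (to (2*[x+y]≡3*y+1⇔ x y) 2g≡c+1)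
  PseudoSymmetric⇒ (g , c , G , C , 2g≡c+1) | refl | no x≰y with <⇒≡suc (ℕ.≰⇒> x≰y)
  ... | x′ , x≡1+x′ , y≤x′ with IsConductor-unique (conductor-> x≡1+x′ y≤x′) C
  ...   | refl = let 2y≡1+x′ = to (2*[1+x+y]≡2+3*x+1⇔ x′ y)
                                 (subst (λ x → 2 * (x + y) ≡ 2 + 3 * x′ + 1) x≡1+x′ 2g≡c+1)
                 in inj₁ (trans 2y≡1+x′ (sym x≡1+x′) , 2*y≡1+x⇒0<y 2y≡1+x′)

  PseudoSymmetric⇐ : PseudoSymmetricCoordinates x y → PseudoSymmetric H
  PseudoSymmetric⇐ (inj₁ (2y≡x , 0<y)) =
    let y<x = subst (y <_) 2y≡x (ℕ.m<m+n y (ℕ.<-≤-trans 0<y (ℕ.m≤m+n y 0)))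
        x′ , x≡1+x′ , y≤x′ = <⇒≡suc y<x in
    x + y , 2 + 3 * x′ , genus , conductor-> x≡1+x′ y≤x′ ,
    subst (λ x → 2 * (x + y) ≡ 2 + 3 * x′ + 1) (sym x≡1+x′)
      (from (2*[1+x+y]≡2+3*x+1⇔ x′ y) (trans 2y≡x x≡1+x′))
  PseudoSymmetric⇐ (inj₂ 2x≡1+y) = x + y , 3 * y , genus , conductor-≤ (2*x≡1+y⇒x≤y 2x≡1+y) ,
    from (2*[x+y]≡3*y+1⇔ x y) 2x≡1+y

  Multiplicity⇒ : Multiplicity H 3 → 0 < x × 0 < y
  Multiplicity⇒ (_ , _ , 3≤) =
    ℕ.n≢0⇒n>0 (λ x≡0 → ℕ.1+n≰n (ℕ.m≤n⇒m≤1+n (3≤ 1 (s≤s z≤n) (1∈ x≡0)))) ,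
    ℕ.n≢0⇒n>0 (λ y≡0 → ℕ.1+n≰n (3≤ 2 (s≤s z≤n) (2∈ y≡0)))
    where
    1∈ : x ≡ 0 → H 1
    1∈ x≡0 = Kunz⇒H (Kunz-1+3*⁺ x y 0 (ℕ.≤-reflexive x≡0))
    2∈ : y ≡ 0 → H 2
    2∈ y≡0 = Kunz⇒H (Kunz-2+3*⁺ x y 0 (ℕ.≤-reflexive y≡0))

  Multiplicity⇐ : 0 < x → 0 < y → Multiplicity H 3
  Multiplicity⇐ 0<x 0<y = s≤s z≤n , Kunz⇒H (kunz-3* x y 1) , 3≤
    where
    3≤ : ∀ k → 0 < k → H k → 3 ≤ k
    3≤ k 0<k k∈ with residue3 k
    3≤ k () k∈ | mod0 zero
    ... | mod0 (suc m) = ℕ.m≤m*n 3 (suc m)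
    ... | mod1 m = ℕ.m≤n⇒m≤1+n (ℕ.*-monoʳ-≤ 3 (≤-trans 0<x (Kunz-1+3*⁻ x y m (H⇒Kunz k∈))))
    ... | mod2 m = ℕ.m≤n⇒m≤o+n 2 (ℕ.*-monoʳ-≤ 3 (≤-trans 0<y (Kunz-2+3*⁻ x y m (H⇒Kunz k∈))))

  MinimalGenerator⇒ : ∀ {n} → MinimalGenerator H n → n ≡ 3 ⊎ n ≡ 1 + 3 * x ⊎ n ≡ 2 + 3 * y
  MinimalGenerator⇒ {n} (0<n , n∈ , indecomposable) with residue3 n
  MinimalGenerator⇒ (() , _) | mod0 zero
  ... | mod0 (suc zero) = inj₁ refl
  ... | mod0 (suc (suc m)) = ⊥-elim (indecomposable (3 , 3 * suc m , s≤s z≤n , s≤s z≤n ,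
          Kunz⇒H (kunz-3* x y 1) , Kunz⇒H (kunz-3* x y (suc m)) , sym (ℕ.*-suc 3 (suc m))))
  ... | mod1 m with ℕ.m≤n⇒m<n∨m≡n (Kunz-1+3*⁻ x y m (H⇒Kunz n∈))
  ...   | inj₂ refl = inj₂ (inj₁ refl)
  ...   | inj₁ x<m = ⊥-elim (indecomposable (1 + 3 * x , 3 * (m ∸ x) , s≤s z≤n ,
          ℕ.*-monoʳ-< 3 (ℕ.m<n⇒0<n∸m x<m) , Kunz⇒H (Kunz-1+3*⁺ x y x ≤-refl) , Kunz⇒H (kunz-3* x y (m ∸ x)) ,
          [r+3*x]+3*[m∸x]≡r+3*m 1 (ℕ.<⇒≤ x<m)))
  MinimalGenerator⇒ {n} (0<n , n∈ , indecomposable) | mod2 m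
    with ℕ.m≤n⇒m<n∨m≡n (Kunz-2+3*⁻ x y m (H⇒Kunz n∈))
  ...   | inj₂ refl = inj₂ (inj₂ refl)
  ...   | inj₁ y<m = ⊥-elim (indecomposable (2 + 3 * y , 3 * (m ∸ y) , s≤s z≤n ,
          ℕ.*-monoʳ-< 3 (ℕ.m<n⇒0<n∸m y<m) , Kunz⇒H (Kunz-2+3*⁺ x y y ≤-refl) , Kunz⇒H (kunz-3* x y (m ∸ y)) ,
          [r+3*x]+3*[m∸x]≡r+3*m 2 (ℕ.<⇒≤ y<m)))

  at-most-two-generators : ∀ {g} → (∀ {n} → MinimalGenerator H n → n ∈ 3 ∷ g ∷ []) → ¬ EmbeddingDimension H 3
  at-most-two-generators generated-by ED = ℕ.1+n≰n (CountIs-≤-length ED generated-by)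

  EmbeddingDimension⇒ : EmbeddingDimension H 3 → ¬ SymmetricCoordinates x y
  EmbeddingDimension⇒ ED (inj₁ 2x≡y) = at-most-two-generators generated-by ED
    where
    1+3x∈ : H (1 + 3 * x)
    1+3x∈ = Kunz⇒H (Kunz-1+3*⁺ x y x ≤-refl)
    generated-by : ∀ {n} → MinimalGenerator H n → n ∈ 3 ∷ 1 + 3 * x ∷ []
    generated-by mg with MinimalGenerator⇒ mg
    ... | inj₁ refl = here refl
    ... | inj₂ (inj₁ refl) = there (here refl)
    ... | inj₂ (inj₂ refl) = ⊥-elim (proj₂ (proj₂ mg) (_ , _ , s≤s z≤n , s≤s z≤n , 1+3x∈ , 1+3x∈ ,
            subst (λ y → 1 + 3 * x + (1 + 3 * x) ≡ 2 + 3 * y) 2x≡y (twice-1+3* x)))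
  EmbeddingDimension⇒ ED (inj₂ x≡1+2y) = at-most-two-generators generated-by ED
    where
    2+3y∈ : H (2 + 3 * y)
    2+3y∈ = Kunz⇒H (Kunz-2+3*⁺ x y y ≤-refl)
    generated-by : ∀ {n} → MinimalGenerator H n → n ∈ 3 ∷ 2 + 3 * y ∷ []
    generated-by mg with MinimalGenerator⇒ mg
    ... | inj₁ refl = here refl
    ... | inj₂ (inj₂ refl) = there (here refl)
    ... | inj₂ (inj₁ refl) = ⊥-elim (proj₂ (proj₂ mg) (_ , _ , s≤s z≤n , s≤s z≤n , 2+3y∈ , 2+3y∈ ,
            subst (λ x → 2 + 3 * y + (2 + 3 * y) ≡ 1 + 3 * x) (sym x≡1+2y) (twice-2+3* y)))

  EmbeddingDimension⇐ : y ≤ 2 * x → x ≤ suc (2 * y) → MedimCoordinates x y → EmbeddingDimension H 3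
  EmbeddingDimension⇐ y≤2x x≤1+2y (0<x , 0<y , ¬sym) =
    3 ∷ 1 + 3 * x ∷ 2 + 3 * y ∷ [] , distinct , minimal , generated-by , refl
    where
    distinct : Unique (3 ∷ 1 + 3 * x ∷ 2 + 3 * y ∷ [])
    distinct = ((λ e → contradiction (residue-cong {0} {1} {1} {x} e) λ ()) All.∷
                (λ e → contradiction (residue-cong {0} {2} {1} {y} e) λ ()) All.∷ All.[]) ∷
               ((λ e → contradiction (residue-cong {1} {2} {x} {y} e) λ ()) All.∷ All.[]) ∷ All.[] ∷ []
    3-indecomposable : ¬ (∃₂ λ a b → 0 < a × 0 < b × H a × H b × a + b ≡ 3)
    3-indecomposable (1 , _ , _ , _ , 1∈ , _ , _) = ℕ.<⇒≱ 0<x (Kunz-1+3*⁻ x y 0 (H⇒Kunz 1∈))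
    3-indecomposable (2 , _ , _ , _ , 2∈ , _ , _) = ℕ.<⇒≱ 0<y (Kunz-2+3*⁻ x y 0 (H⇒Kunz 2∈))
    3-indecomposable (suc (suc (suc a)) , _ , _ , 0<b , _ , _ , a+b≡3) =
      ℕ.<⇒≱ (m+n≡o⇒m<o 0<b a+b≡3) (ℕ.m≤m+n 3 a)
    minimal : ∀ n → n ∈ 3 ∷ 1 + 3 * x ∷ 2 + 3 * y ∷ [] → MinimalGenerator H n
    minimal n (here refl) = s≤s z≤n , Kunz⇒H (kunz-3* x y 1) , 3-indecomposable
    minimal n (there (here refl)) = s≤s z≤n , Kunz⇒H (Kunz-1+3*⁺ x y x ≤-refl) ,
      λ (a , b , 0<a , 0<b , a∈ , b∈ , a+b≡) →
        1+3*-indecomposable y≤2x (ℕ.≤∧≢⇒< x≤1+2y (¬sym ∘ inj₂)) 0<a 0<b (H⇒Kunz a∈) (H⇒Kunz b∈) a+b≡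
    minimal n (there (there (here refl))) = s≤s z≤n , Kunz⇒H (Kunz-2+3*⁺ x y y ≤-refl) ,
      λ (a , b , 0<a , 0<b , a∈ , b∈ , a+b≡) →
        2+3*-indecomposable (ℕ.≤∧≢⇒< y≤2x (¬sym ∘ inj₁ ∘ sym)) x≤1+2y 0<a 0<b (H⇒Kunz a∈) (H⇒Kunz b∈) a+b≡
    generated-by : ∀ n → MinimalGenerator H n → n ∈ 3 ∷ 1 + 3 * x ∷ 2 + 3 * y ∷ []
    generated-by n mg with MinimalGenerator⇒ mg
    ... | inj₁ refl = here refl
    ... | inj₂ (inj₁ refl) = there (here refl)
    ... | inj₂ (inj₂ refl) = there (there (here refl))

module Encoded {q x y : ℕ} (A : Admissible q x y) = KunzSemigroup {x} {y} {In (encode q x y)} (encode⁻ A) (encode⁺ A)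

NCount-of : ∀ {q n} → CountIs (uncurry (Admissible q)) n → NCount 3 q n
NCount-of #adm = CountIs-cong proj₁ (_, tt)
  (CountIs-encode {P = λ _ → ⊤} {C = λ _ _ → ⊤} (λ _ _ → tt) (λ _ _ → tt) (CountIs-cong (_, tt) proj₁ #adm))

MedimCount-of : ∀ {q n} → CountIs (uncurry (Admissible q) ∩ uncurry MedimCoordinates) n → MedimCount 3 q n
MedimCount-of = CountIs-encode
  (λ A (mult , ed) → let 0<x , 0<y = Encoded.Multiplicity⇒ A mult in 0<x , 0<y , Encoded.EmbeddingDimension⇒ A ed)
  (λ A med@(0<x , 0<y , _) →
    Encoded.Multiplicity⇐ A 0<x 0<y , Encoded.EmbeddingDimension⇐ A (Admissible.y≤2x A) (Admissible.x≤1+2y A) med)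

SymCount-of : ∀ {q n} → CountIs (uncurry λ x y → Admissible q x y × SymmetricCoordinates x y) n → SymCount 3 q n
SymCount-of = CountIs-encode (λ A → Encoded.Symmetric⇒ A) (λ A → Encoded.Symmetric⇐ A)

PsymCount-of : ∀ {q n} → CountIs (uncurry λ x y → Admissible q x y × PseudoSymmetricCoordinates x y) n →
               PsymCount 3 q n
PsymCount-of = CountIs-encode (λ A → Encoded.PseudoSymmetric⇒ A) (λ A → Encoded.PseudoSymmetric⇐ A)

-- Counting Kunz coordinates

module _ (a x y : ℕ) where

  Admissible-1+3*⇔ : Admissible (1 + 3 * a) x y ⇔ (x < suc a × ⌊ x /2⌋ ≤ y × y < suc (2 * x))
  Admissible-1+3*⇔ = mk⇔
    (λ (admissible y≤2x x≤1+2y q∈ _ _) →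
      s≤s (Kunz-1+3*⁻ x y a q∈) , from (⌊n/2⌋≤m⇔n≤1+2*m x y) x≤1+2y , s≤s y≤2x)
    (λ { (s≤s x≤a , h≤y , s≤s y≤2x) →
      admissible y≤2x (to (⌊n/2⌋≤m⇔n≤1+2*m x y) h≤y) (Kunz-1+3*⁺ x y a x≤a)
        (ℕ.m≤n⇒m≤1+n (≤-trans x≤a (ℕ.m≤n*m a 3)))
        (ℕ.m≤n⇒m≤1+n (≤-trans y≤2x (≤-trans (ℕ.*-monoʳ-≤ 2 x≤a) (ℕ.*-monoˡ-≤ a (ℕ.n≤1+n 2))))) })

  Admissible-2+3*⇔ : Admissible (2 + 3 * a) x y ⇔ (y < suc a × ⌊ suc y /2⌋ ≤ x × x < suc (suc (2 * y)))
  Admissible-2+3*⇔ = mk⇔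
    (λ (admissible y≤2x x≤1+2y q∈ _ _) →
      s≤s (Kunz-2+3*⁻ x y a q∈) , from (⌊n/2⌋≤m⇔n≤1+2*m (suc y) x) (s≤s y≤2x) , s≤s x≤1+2y)
    (λ { (s≤s y≤a , h≤x , s≤s x≤1+2y) →
      admissible (ℕ.≤-pred (to (⌊n/2⌋≤m⇔n≤1+2*m (suc y) x) h≤x)) x≤1+2y (Kunz-2+3*⁺ x y a y≤a)
        (≤-trans x≤1+2y (s≤s (ℕ.m≤n⇒m≤1+n
          (≤-trans (ℕ.*-monoʳ-≤ 2 y≤a) (ℕ.*-monoˡ-≤ a (ℕ.n≤1+n 2))))))
        (ℕ.m≤n⇒m≤o+n 2 (≤-trans y≤a (ℕ.m≤n*m a 3))) })

Admissible-1+3*⇒x≤a : ∀ {a x y} → Admissible (1 + 3 * a) x y → x ≤ a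
Admissible-1+3*⇒x≤a {a} {x} {y} A = Kunz-1+3*⁻ x y a (Admissible.q∈ A)

Admissible-2+3*⇒y≤a : ∀ {a x y} → Admissible (2 + 3 * a) x y → y ≤ a
Admissible-2+3*⇒y≤a {a} {x} {y} A = Kunz-2+3*⁻ x y a (Admissible.q∈ A)

row-1+3* : ℕ → ℕ
row-1+3* x = suc (2 * x) ∸ ⌊ x /2⌋

row-2+3* : ℕ → ℕ
row-2+3* y = suc (suc (2 * y)) ∸ ⌊ suc y /2⌋

RowBounds : (ℕ → ℕ) → Set
RowBounds r = ∀ x → 9 * suc (2 * x) + 3 ≤ 12 * r x × 12 * r x ≤ 9 * suc (2 * x) + 15

row-1+3*-bounds : RowBounds row-1+3*
row-1+3*-bounds x =
  ℕ.+-cancelʳ-≤ (6 * x) _ _ (subst (_≤ 12 * row-1+3* x + 6 * x) (sym (lower-eq x)) (proj₁ bounds)) ,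
  ℕ.+-cancelʳ-≤ (6 * x) _ _ (≤-trans (proj₂ bounds) (≤-slack 6 (upper-eq x)))
  where
  bounds : 12 * suc (2 * x) ≤ 12 * row-1+3* x + 6 * x × 12 * row-1+3* x + 6 * x ≤ 12 * suc (2 * x) + 6
  bounds = row-bounds (suc (2 * x)) x (≤-trans (ℕ.⌊n/2⌋≤n x) (ℕ.m≤n⇒m≤1+n (x≤2*x x)))
  lower-eq : ∀ x → 9 * suc (2 * x) + 3 + 6 * x ≡ 12 * suc (2 * x)
  lower-eq = solve-∀
  upper-eq : ∀ x → 12 * suc (2 * x) + 6 + 6 ≡ 9 * suc (2 * x) + 15 + 6 * x
  upper-eq = solve-∀

row-2+3*-bounds : RowBounds row-2+3*
row-2+3*-bounds y =
  ℕ.+-cancelʳ-≤ (6 * suc y) _ _ (≤-trans (≤-slack 6 (lower-eq y)) (proj₁ bounds)) ,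
  ℕ.+-cancelʳ-≤ (6 * suc y) _ _ (subst (12 * row-2+3* y + 6 * suc y ≤_) (upper-eq y) (proj₂ bounds))
  where
  bounds : 12 * suc (suc (2 * y)) ≤ 12 * row-2+3* y + 6 * suc y ×
           12 * row-2+3* y + 6 * suc y ≤ 12 * suc (suc (2 * y)) + 6
  bounds = row-bounds (suc (suc (2 * y))) (suc y)
                      (≤-trans (ℕ.⌊n/2⌋≤n (suc y)) (s≤s (ℕ.m≤n⇒m≤1+n (x≤2*x y))))
  lower-eq : ∀ y → 9 * suc (2 * y) + 3 + 6 * suc y + 6 ≡ 12 * suc (suc (2 * y))
  lower-eq = solve-∀
  upper-eq : ∀ y → 12 * suc (suc (2 * y)) + 6 ≡ 9 * suc (2 * y) + 15 + 6 * suc y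
  upper-eq = solve-∀

12*Σ<-bounds : ∀ {r} → RowBounds r → ∀ b →
               9 * (b * b) + 3 * b ≤ 12 * Σ< b r × 12 * Σ< b r ≤ 9 * (b * b) + 15 * b
12*Σ<-bounds {r} bounds b =
  subst (9 * (b * b) + 3 * b ≤_) (Σ<-*ˡ 12 r b) (Σ<-lower 9 3 (proj₁ ∘ bounds) b) ,
  subst (_≤ 9 * (b * b) + 15 * b) (Σ<-*ˡ 12 r b) (Σ<-upper 9 15 (proj₂ ∘ bounds) b)

count-1+3* : ∀ a → CountIs (uncurry (Admissible (1 + 3 * a))) (Σ< (suc a) row-1+3*)
count-1+3* a = CountIs-cong (from (Admissible-1+3*⇔ a _ _)) (to (Admissible-1+3*⇔ a _ _))
  (CountIs-rows (λ x → CountIs-interval ⌊ x /2⌋ (suc (2 * x))) (suc a))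

count-2+3* : ∀ a → CountIs (uncurry (Admissible (2 + 3 * a))) (Σ< (suc a) row-2+3*)
count-2+3* a = CountIs-image swap (λ _ _ → cong swap) (from (Admissible-2+3*⇔ a _ _))
  (λ {(x , y)} A → (y , x) , to (Admissible-2+3*⇔ a x y) A , refl)
  (CountIs-rows (λ y → CountIs-interval ⌊ suc y /2⌋ (suc (suc (2 * y)))) (suc a))

square-estimate : ∀ {N} q b → q * q ≤ 9 * (b * b) + 3 * b → 9 * (b * b) + 15 * b ≤ q * q + 24 * q →
                  9 * (b * b) + 3 * b ≤ 12 * N × 12 * N ≤ 9 * (b * b) + 15 * b → ∣ N * 12 - q * q ∣ ≤ 24 * q
square-estimate {N} q b q²≤ ≤q²+24q (lower , upper) = ∣-∣≤
  (subst (_≤ q * q + 24 * q) (ℕ.*-comm 12 N) (≤-trans upper ≤q²+24q))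
  (≤-trans q²≤ (≤-trans lower (subst (_≤ N * 12 + 24 * q) (ℕ.*-comm N 12) (ℕ.m≤m+n (N * 12) (24 * q)))))

admissible-estimate : ∀ {q} → Coprime 3 q →
                      ∃ λ n → CountIs (uncurry (Admissible q)) n × ∣ n * 12 - q * q ∣ ≤ 24 * q
admissible-estimate q⊥3 with coprime-to-3 q⊥3
... | inj₁ (a , refl) = _ , count-1+3* a ,
  square-estimate {Σ< (suc a) row-1+3*} (1 + 3 * a) (suc a)
    (≤-slack (15 * a + 11) (lower-eq a)) (≤-slack (45 * a + 1) (upper-eq a))
    (12*Σ<-bounds {row-1+3*} row-1+3*-bounds (suc a))
  where
  lower-eq : ∀ a → (1 + 3 * a) * (1 + 3 * a) + (15 * a + 11) ≡ 9 * (suc a * suc a) + 3 * suc a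
  lower-eq = solve-∀
  upper-eq : ∀ a → 9 * (suc a * suc a) + 15 * suc a + (45 * a + 1) ≡ (1 + 3 * a) * (1 + 3 * a) + 24 * (1 + 3 * a)
  upper-eq = solve-∀
... | inj₂ (a , refl) = _ , count-2+3* a ,
  square-estimate {Σ< (suc a) row-2+3*} (2 + 3 * a) (suc a)
    (≤-slack (9 * a + 8) (lower-eq a)) (≤-slack (51 * a + 28) (upper-eq a))
    (12*Σ<-bounds {row-2+3*} row-2+3*-bounds (suc a))
  where
  lower-eq : ∀ a → (2 + 3 * a) * (2 + 3 * a) + (9 * a + 8) ≡ 9 * (suc a * suc a) + 3 * suc a
  lower-eq = solve-∀
  upper-eq : ∀ a → 9 * (suc a * suc a) + 15 * suc a + (51 * a + 28) ≡ (2 + 3 * a) * (2 + 3 * a) + 24 * (2 + 3 * a)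
  upper-eq = solve-∀

N-estimate : ∀ {q} → Coprime 3 q → ∃ λ n → NCount 3 q n × ∣ n * 12 - q * q ∣ ≤ 24 * q
N-estimate q⊥3 = let n , #admissible , close = admissible-estimate q⊥3 in n , NCount-of #admissible , close

sym-line₁ sym-line₂ psym-line₁ psym-line₂ : ℕ → ℕ × ℕ
sym-line₁ t = t , 2 * t
sym-line₂ t = suc (2 * t) , t
psym-line₁ t = 2 * suc t , suc t
psym-line₂ t = suc t , suc (2 * t)

sym-lines-disjoint : ∀ {s t} → sym-line₁ s ≢ sym-line₂ t
sym-lines-disjoint {s} {t} eq = ℕ.<⇒≢ (ℕ.<-≤-trans (s≤s (x≤2*x t)) (x≤2*x (suc (2 * t))))
  (trans (sym (cong proj₂ eq)) (cong (2 *_) (cong proj₁ eq)))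

psym-lines-disjoint : ∀ {s t} → psym-line₁ s ≢ psym-line₂ t
psym-lines-disjoint {s} {t} eq = ℕ.<⇒≢ (ℕ.≤-<-trans (s≤s (x≤2*x t)) (ℕ.m<m+n (suc (2 * t)) (s≤s z≤n)))
  (trans (sym (cong proj₁ eq)) (cong (λ k → 2 * k) (cong proj₂ eq)))

CountIs-sym-lines : ∀ k l → CountIs (Range sym-line₁ k ∪ Range sym-line₂ l) (k + l)
CountIs-sym-lines k l = CountIs-Range-∪ (cong proj₁) (cong proj₂) sym-lines-disjoint

sym-lines⊆ : ∀ {k l p} → (Range sym-line₁ k ∪ Range sym-line₂ l) p → uncurry SymmetricCoordinates p
sym-lines⊆ (inj₁ (_ , _ , refl)) = inj₁ refl
sym-lines⊆ (inj₂ (_ , _ , refl)) = inj₂ refl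

medim? : Decidable (uncurry MedimCoordinates)
medim? (x , y) = 0 ℕ.<? x ×-dec 0 ℕ.<? y ×-dec ¬? (2 * x ℕ.≟ y ⊎-dec x ℕ.≟ suc (2 * y))

non-medim⊆sym-lines : ∀ {q x y} → Admissible q x y → ¬ MedimCoordinates x y →
                      (Range sym-line₁ (suc q) ∪ Range sym-line₂ (suc q)) (x , y)
non-medim⊆sym-lines {x = zero} (admissible z≤n _ _ _ _) _ = inj₁ (0 , s≤s z≤n , refl)
non-medim⊆sym-lines {x = suc zero} {zero} _ _ = inj₂ (0 , s≤s z≤n , refl)
non-medim⊆sym-lines {x = suc (suc x)} {zero} (admissible _ (s≤s ()) _ _ _) _
non-medim⊆sym-lines {x = suc x} {suc y} A ¬medim with 2 * suc x ℕ.≟ suc y | suc x ℕ.≟ suc (2 * suc y)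
... | yes 2x≡y | _ = inj₁ (suc x , s≤s (Admissible.x≤q A) , cong (suc x ,_) 2x≡y)
... | no _ | yes x≡1+2y = inj₂ (suc y , s≤s (Admissible.y≤q A) , cong (_, suc y) (sym x≡1+2y))
... | no 2x≢y | no x≢1+2y = ⊥-elim (¬medim (s≤s z≤n , s≤s z≤n , [ 2x≢y , x≢1+2y ]))

medim-estimate : ∀ {q} → Coprime 3 q → ∃ λ m → MedimCount 3 q m × ∣ m * 12 - q * q ∣ ≤ 72 * q
medim-estimate {q} q⊥3 with admissible-estimate q⊥3
... | N , #admissible , N-close with CountIs-filter medim? #admissible
... | m , #medim = m , MedimCount-of #medim ,
  ≤-trans (shift-estimate 12 (CountIs-mono proj₁ #medim #admissible) N≤m+2[q+1] N-close) error-bound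
  where
  split : uncurry (Admissible q) ⊆
          (uncurry (Admissible q) ∩ uncurry MedimCoordinates) ∪ (Range sym-line₁ (suc q) ∪ Range sym-line₂ (suc q))
  split {x , y} A with medim? (x , y)
  ... | yes medim = inj₁ (A , medim)
  ... | no ¬medim = inj₂ (non-medim⊆sym-lines A ¬medim)
  N≤m+2[q+1] : N ≤ m + (suc q + suc q)
  N≤m+2[q+1] = CountIs-mono split #admissible
    (CountIs-∪ (λ (_ , _ , _ , ¬sym) on-line → ¬sym (sym-lines⊆ on-line)) #medim
               (CountIs-sym-lines (suc q) (suc q)))
  error-bound : (suc q + suc q) * 12 + 24 * q ≤ 72 * q
  error-bound = begin
    (suc q + suc q) * 12 + 24 * q  ≡⟨ lhs q ⟩
    48 * q + 24 * 1                ≤⟨ ℕ.+-monoʳ-≤ (48 * q) (ℕ.*-monoʳ-≤ 24 (coprime-to-3⇒0<q q⊥3)) ⟩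
    48 * q + 24 * q                ≡⟨ rhs q ⟩
    72 * q                         ∎
    where
    open ≤-Reasoning
    lhs : ∀ q → (suc q + suc q) * 12 + 24 * q ≡ 48 * q + 24 * 1
    lhs = solve-∀
    rhs : ∀ q → 48 * q + 24 * q ≡ 72 * q
    rhs = solve-∀

sym-count-1+3* : ∀ a → CountIs (uncurry λ x y → Admissible (1 + 3 * a) x y × SymmetricCoordinates x y)
                               (suc a + ⌊ suc a /2⌋)
sym-count-1+3* a = CountIs-cong lines⊆ ⊆lines (CountIs-sym-lines (suc a) ⌊ suc a /2⌋)
  where
  adm : ∀ x y → x < suc a × ⌊ x /2⌋ ≤ y × y < suc (2 * x) → Admissible (1 + 3 * a) x y
  adm x y = from (Admissible-1+3*⇔ a x y)
  lines⊆ : Range sym-line₁ (suc a) ∪ Range sym-line₂ ⌊ suc a /2⌋ ⊆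
           uncurry λ x y → Admissible (1 + 3 * a) x y × SymmetricCoordinates x y
  lines⊆ (inj₁ (t , t<1+a , refl)) =
    adm t (2 * t) (t<1+a , ≤-trans (ℕ.⌊n/2⌋≤n t) (x≤2*x t) , ℕ.n<1+n _) , inj₁ refl
  lines⊆ (inj₂ (t , t<h , refl)) =
    adm (suc (2 * t)) t (to (<⌊n/2⌋⇔1+2*t<n t (suc a)) t<h , ⌊1+2*t/2⌋≤t t , t<1+2*[1+2*t] t) , inj₂ refl
  ⊆lines : uncurry (λ x y → Admissible (1 + 3 * a) x y × SymmetricCoordinates x y) ⊆
           Range sym-line₁ (suc a) ∪ Range sym-line₂ ⌊ suc a /2⌋
  ⊆lines {x , y} (A , inj₁ 2x≡y) = inj₁ (x , s≤s (Admissible-1+3*⇒x≤a A) , cong (x ,_) 2x≡y)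
  ⊆lines {x , y} (A , inj₂ x≡1+2y) =
    inj₂ (y , from (<⌊n/2⌋⇔1+2*t<n y (suc a)) (s≤s (subst (_≤ a) x≡1+2y (Admissible-1+3*⇒x≤a A))) ,
          cong (_, y) (sym x≡1+2y))

sym-count-2+3* : ∀ a → CountIs (uncurry λ x y → Admissible (2 + 3 * a) x y × SymmetricCoordinates x y)
                               (⌊ suc (suc a) /2⌋ + suc a)
sym-count-2+3* a = CountIs-cong lines⊆ ⊆lines (CountIs-sym-lines ⌊ suc (suc a) /2⌋ (suc a))
  where
  adm : ∀ x y → y < suc a × ⌊ suc y /2⌋ ≤ x × x < suc (suc (2 * y)) → Admissible (2 + 3 * a) x y
  adm x y = from (Admissible-2+3*⇔ a x y)
  lines⊆ : Range sym-line₁ ⌊ suc (suc a) /2⌋ ∪ Range sym-line₂ (suc a) ⊆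
           uncurry λ x y → Admissible (2 + 3 * a) x y × SymmetricCoordinates x y
  lines⊆ (inj₁ (t , t<h , refl)) =
    adm t (2 * t) (ℕ.≤-pred (to (<⌊n/2⌋⇔1+2*t<n t (suc (suc a))) t<h) , ⌊1+2*t/2⌋≤t t ,
                   s≤s (ℕ.m≤n⇒m≤1+n (≤-trans (x≤2*x t) (x≤2*x (2 * t))))) , inj₁ refl
  lines⊆ (inj₂ (t , t<1+a , refl)) =
    adm (suc (2 * t)) t (t<1+a , ≤-trans (ℕ.⌊n/2⌋≤n (suc t)) (s≤s (x≤2*x t)) , ≤-refl) , inj₂ refl
  ⊆lines : uncurry (λ x y → Admissible (2 + 3 * a) x y × SymmetricCoordinates x y) ⊆
           Range sym-line₁ ⌊ suc (suc a) /2⌋ ∪ Range sym-line₂ (suc a)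
  ⊆lines {x , y} (A , inj₁ 2x≡y) =
    inj₁ (x , from (<⌊n/2⌋⇔1+2*t<n x (suc (suc a)))
                   (s≤s (s≤s (subst (_≤ a) (sym 2x≡y) (Admissible-2+3*⇒y≤a A)))) ,
          cong (x ,_) 2x≡y)
  ⊆lines {x , y} (A , inj₂ x≡1+2y) = inj₂ (y , s≤s (Admissible-2+3*⇒y≤a A) , cong (_, y) (sym x≡1+2y))

CountIs-psym-lines : ∀ k l → CountIs (Range psym-line₁ k ∪ Range psym-line₂ l) (k + l)
CountIs-psym-lines k l =
  CountIs-Range-∪ (ℕ.suc-injective ∘ cong proj₂) (ℕ.suc-injective ∘ cong proj₁) psym-lines-disjoint

2*[1+t]≡1+y⇒y≡1+2*t : ∀ {t y} → 2 * suc t ≡ suc y → suc (2 * t) ≡ y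
2*[1+t]≡1+y⇒y≡1+2*t {t} eq = ℕ.suc-injective (trans (sym (ℕ.*-suc 2 t)) eq)

psym-count-1+3* : ∀ a → CountIs (uncurry λ x y → Admissible (1 + 3 * a) x y × PseudoSymmetricCoordinates x y)
                                (⌊ a /2⌋ + a)
psym-count-1+3* a = CountIs-cong lines⊆ ⊆lines (CountIs-psym-lines ⌊ a /2⌋ a)
  where
  adm : ∀ x y → x < suc a × ⌊ x /2⌋ ≤ y × y < suc (2 * x) → Admissible (1 + 3 * a) x y
  adm x y = from (Admissible-1+3*⇔ a x y)
  lines⊆ : Range psym-line₁ ⌊ a /2⌋ ∪ Range psym-line₂ a ⊆
           uncurry λ x y → Admissible (1 + 3 * a) x y × PseudoSymmetricCoordinates x y
  lines⊆ (inj₁ (t , t<h , refl)) = adm (2 * suc t) (suc t)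
    (s≤s (subst (_≤ a) (sym (ℕ.*-suc 2 t)) (to (<⌊n/2⌋⇔1+2*t<n t a) t<h)) ,
     from (⌊n/2⌋≤m⇔n≤1+2*m (2 * suc t) (suc t)) (ℕ.n≤1+n _) ,
     s≤s (≤-trans (x≤2*x (suc t)) (x≤2*x (2 * suc t)))) ,
    inj₁ (refl , s≤s z≤n)
  lines⊆ (inj₂ (t , t<a , refl)) = adm (suc t) (suc (2 * t))
    (s≤s t<a , ≤-trans (ℕ.⌊n/2⌋≤n (suc t)) (s≤s (x≤2*x t)) ,
     s≤s (subst (suc (2 * t) ≤_) (sym (ℕ.*-suc 2 t)) (ℕ.n≤1+n _))) ,
    inj₂ (ℕ.*-suc 2 t)
  ⊆lines : uncurry (λ x y → Admissible (1 + 3 * a) x y × PseudoSymmetricCoordinates x y) ⊆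
           Range psym-line₁ ⌊ a /2⌋ ∪ Range psym-line₂ a
  ⊆lines {x , suc t} (A , inj₁ (2y≡x , _)) =
    inj₁ (t , from (<⌊n/2⌋⇔1+2*t<n t a) (subst (_≤ a) (trans (sym 2y≡x) (ℕ.*-suc 2 t)) (Admissible-1+3*⇒x≤a A))
            , cong (_, suc t) 2y≡x)
  ⊆lines {suc t , y} (A , inj₂ 2x≡1+y) =
    inj₂ (t , Admissible-1+3*⇒x≤a A , cong (suc t ,_) (2*[1+t]≡1+y⇒y≡1+2*t 2x≡1+y))

psym-count-2+3* : ∀ a → CountIs (uncurry λ x y → Admissible (2 + 3 * a) x y × PseudoSymmetricCoordinates x y)
                                (a + ⌊ suc a /2⌋)
psym-count-2+3* a = CountIs-cong lines⊆ ⊆lines (CountIs-psym-lines a ⌊ suc a /2⌋)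
  where
  adm : ∀ x y → y < suc a × ⌊ suc y /2⌋ ≤ x × x < suc (suc (2 * y)) → Admissible (2 + 3 * a) x y
  adm x y = from (Admissible-2+3*⇔ a x y)
  lines⊆ : Range psym-line₁ a ∪ Range psym-line₂ ⌊ suc a /2⌋ ⊆
           uncurry λ x y → Admissible (2 + 3 * a) x y × PseudoSymmetricCoordinates x y
  lines⊆ (inj₁ (t , t<a , refl)) = adm (2 * suc t) (suc t)
    (s≤s t<a ,
     ≤-trans (ℕ.⌊n/2⌋≤n (suc (suc t))) (subst (suc (suc t) ≤_) (sym (ℕ.*-suc 2 t)) (s≤s (s≤s (x≤2*x t)))) ,
     s≤s (ℕ.n≤1+n _)) ,
    inj₁ (refl , s≤s z≤n)
  lines⊆ (inj₂ (t , t<h , refl)) = adm (suc t) (suc (2 * t))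
    (to (<⌊n/2⌋⇔1+2*t<n t (suc a)) t<h ,
     from (⌊n/2⌋≤m⇔n≤1+2*m (suc (suc (2 * t))) (suc t))
          (subst (suc (suc (2 * t)) ≤_) (cong suc (sym (ℕ.*-suc 2 t))) (ℕ.n≤1+n _)) ,
     s≤s (s≤s (≤-trans (ℕ.m≤n⇒m≤1+n (x≤2*x t)) (x≤2*x (suc (2 * t)))))) ,
    inj₂ (ℕ.*-suc 2 t)
  ⊆lines : uncurry (λ x y → Admissible (2 + 3 * a) x y × PseudoSymmetricCoordinates x y) ⊆
           Range psym-line₁ a ∪ Range psym-line₂ ⌊ suc a /2⌋
  ⊆lines {x , suc t} (A , inj₁ (2y≡x , _)) = inj₁ (t , Admissible-2+3*⇒y≤a A , cong (_, suc t) 2y≡x)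
  ⊆lines {suc t , y} (A , inj₂ 2x≡1+y) =
    inj₂ (t , from (<⌊n/2⌋⇔1+2*t<n t (suc a)) (s≤s (subst (_≤ a) (sym y≡1+2t) (Admissible-2+3*⇒y≤a A))) ,
          cong (suc t ,_) y≡1+2t)
    where
    y≡1+2t : suc (2 * t) ≡ y
    y≡1+2t = 2*[1+t]≡1+y⇒y≡1+2*t 2x≡1+y

sym-estimate : ∀ {q} → Coprime 3 q → ∃ λ n → SymCount 3 q n × ∣ n * 2 - q ∣ ≤ 2
sym-estimate q⊥3 with coprime-to-3 q⊥3
... | inj₁ (a , refl) = _ , SymCount-of (sym-count-1+3* a) ,
  half-estimate (suc a) (suc a) (1 + 3 * a) (≤-slack 3 (upper a)) (ℕ.≤-reflexive (lower a))
  where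
  upper : ∀ a → 1 + 3 * a + 3 ≡ 2 * suc a + suc a + 1
  upper = solve-∀
  lower : ∀ a → 2 * suc a + suc a ≡ 1 + 3 * a + 2
  lower = solve-∀
... | inj₂ (a , refl) = _ , SymCount-of (sym-count-2+3* a) ,
  subst (λ n → ∣ n * 2 - (2 + 3 * a) ∣ ≤ 2) (ℕ.+-comm (suc a) ⌊ suc (suc a) /2⌋)
    (half-estimate (suc a) (suc (suc a)) (2 + 3 * a) (≤-slack 3 (upper a)) (ℕ.≤-reflexive (lower a)))
  where
  upper : ∀ a → 2 + 3 * a + 3 ≡ 2 * suc a + suc (suc a) + 1
  upper = solve-∀
  lower : ∀ a → 2 * suc a + suc (suc a) ≡ 2 + 3 * a + 2
  lower = solve-∀

psym-estimate : ∀ {q} → Coprime 3 q → ∃ λ n → PsymCount 3 q n × ∣ n * 2 - q ∣ ≤ 2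
psym-estimate q⊥3 with coprime-to-3 q⊥3
... | inj₁ (a , refl) = _ , PsymCount-of (psym-count-1+3* a) ,
  subst (λ n → ∣ n * 2 - (1 + 3 * a) ∣ ≤ 2) (ℕ.+-comm a ⌊ a /2⌋)
    (half-estimate a a (1 + 3 * a) (ℕ.≤-reflexive (upper a)) (≤-slack 3 (lower a)))
  where
  upper : ∀ a → 1 + 3 * a ≡ 2 * a + a + 1
  upper = solve-∀
  lower : ∀ a → 2 * a + a + 3 ≡ 1 + 3 * a + 2
  lower = solve-∀
... | inj₂ (a , refl) = _ , PsymCount-of (psym-count-2+3* a) ,
  half-estimate a (suc a) (2 + 3 * a) (ℕ.≤-reflexive (upper a)) (≤-slack 3 (lower a))
  where
  upper : ∀ a → 2 + 3 * a ≡ 2 * a + suc a + 1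
  upper = solve-∀
  lower : ∀ a → 2 * a + suc a + 3 ≡ 2 + 3 * a + 2
  lower = solve-∀

proposition6p1 : (LimitPrimeTo3 (NCount 3) (λ q → q * q) (+ 1 / 12) × LimitPrimeTo3 (MedimCount 3) (λ q → q * q) (+ 1 / 12))
    × (LimitPrimeTo3 (SymCount 3) (λ q → q) (+ 1 / 2) × LimitPrimeTo3 (PsymCount 3) (λ q → q) (+ 1 / 2))
proposition6p1 =
  ( limit-from-estimate (NCount 3) (λ q → q * q) (λ q → 24 * q) 11
      (λ _ → N-estimate) (linear-negligible-vs-square 24 11)
  , limit-from-estimate (MedimCount 3) (λ q → q * q) (λ q → 72 * q) 11
      (λ _ → medim-estimate) (linear-negligible-vs-square 72 11) )
  , ( limit-from-estimate (SymCount 3) (λ q → q) (λ _ → 2) 1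
        (λ _ → sym-estimate) (constant-negligible-vs-linear 2 1)
    , limit-from-estimate (PsymCount 3) (λ q → q) (λ _ → 2) 1
        (λ _ → psym-estimate) (constant-negligible-vs-linear 2 1) )
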